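{- Let $N\in\mathbb{N}$. Then for $|q|<1$, \begin{align*} \frac{1}{(q)_N}\sum_{n = 1}^{N} \genfrac{[}{]}{0pt}{}{N}{n}\frac{(-1)^{n - 1}nq^{n(n + 1)/2}}{1 - q^n} & + \sum_{n = 1}^{N} \genfrac{[}{]}{0pt}{}{N}{n} \frac{q^{n^2}}{(q)_n} \sum_{k=1}^n \frac{q^k}{(1-q^k)^2 } = \frac{1}{(q)_N} \sum_{n=1}^{\infty} \frac{n q^n(1- q^{N n})}{1- q^n}. \end{align*}
   Context: Here $(A)_n=(A;q)_n=(1-A)(1-Aq)\cdots(1-Aq^{n-1})$ with $(A)_0=1$, and $\genfrac{[}{]}{0pt}{}{N}{n}=\frac{(q;q)_N}{(q;q)_n(q;q)_{N-n}}$ for $0\le n\le N$ is the $q$-binomial coefficient. -}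

module Defs where

open import Data.Nat as ℕ using (ℕ; zero; suc)
open import Data.Nat.DivMod using (_/_)
open import Data.Integer as ℤ using (ℤ; +_; -1ℤ; 1ℤ; 0ℤ)
open import Data.Vec using (Vec; []; _∷_; head; lookup)
open import Data.Fin using (Fin; toℕ; fromℕ<)
open import Relation.Nullary using (yes; no)

-- Formal power series in q with integer coefficients: coefficient sequences.
PS : Set
PS = ℕ → ℤ

Σ≤ : ℕ → (ℕ → ℤ) → ℤ
Σ≤ zero    f = f 0
Σ≤ (suc m) f = Σ≤ m f ℤ.+ f (suc m)

infixl 6 _⊕_ _⊖_
infixl 7 _⊛_ _•_

_⊕_ : PS → PS → PS
(a ⊕ b) m = a m ℤ.+ b m

_⊖_ : PS → PS → PS
(a ⊖ b) m = a m ℤ.- b m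

_⊛_ : PS → PS → PS
(a ⊛ b) m = Σ≤ m (λ i → a i ℤ.* b (m ℕ.∸ i))

_•_ : ℤ → PS → PS
(c • a) m = c ℤ.* a m

zeroPS : PS
zeroPS _ = 0ℤ

onePS : PS
onePS zero    = 1ℤ
onePS (suc _) = 0ℤ

qpow : ℕ → PS
qpow k m with k ℕ.≟ m
... | yes _ = 1ℤ
... | no  _ = 0ℤ

-- Multiplicative inverse of a power series with constant term 1:
-- b 0 = 1,  b (m+1) = - Σ_{i=1}^{m+1} a i * b (m+1-i).
-- invVec a m = [b m, b (m-1), ..., b 0].
private
  step : PS → (m : ℕ) → Vec ℤ (suc m) → ℤ
  step a m v = ℤ.- Σ≤ m (λ j → a (suc j) ℤ.* look j)
    where
      look : ℕ → ℤ
      look j with j ℕ.<? suc m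
      ... | yes p = lookup v (fromℕ< p)
      ... | no  _ = 0ℤ
      
invVec : PS → (m : ℕ) → Vec ℤ (suc m)
invVec a zero    = 1ℤ ∷ []
invVec a (suc m) = step a m (invVec a m) ∷ invVec a m

inv : PS → PS
inv a m = head (invVec a m)

-- division by a series with constant term 1
_⊘_ : PS → PS → PS
a ⊘ b = a ⊛ inv b

ΣPS : ℕ → (ℕ → PS) → PS
ΣPS zero    f = zeroPS
ΣPS (suc N) f = ΣPS N f ⊕ f (suc N)

-- infinite sum of series  Σ_{n=1}^{∞} f n, for families with f n = O(q^n):
-- coefficient of q^m is Σ_{n=1}^{m} [q^m] f n.
ΣPS∞ : (ℕ → PS) → PS
ΣPS∞ f m = ΣPS m f m

qPoch : ℕ → PS
qPoch zero    = onePS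
qPoch (suc n) = qPoch n ⊛ (onePS ⊖ qpow (suc n))

qBinom : ℕ → ℕ → PS
qBinom N n = qPoch N ⊘ (qPoch n ⊛ qPoch (N ℕ.∸ n))

sgn : ℕ → ℤ
sgn k = -1ℤ ℤ.^ k

lhs₁ : ℕ → PS
lhs₁ N = ΣPS N (λ n → (qBinom N n ⊛ ((sgn (n ℕ.∸ 1) ℤ.* + n) • qpow ((n ℕ.* suc n) / 2)))
                        ⊘ (onePS ⊖ qpow n))
         ⊘ qPoch N

lhs₂ : ℕ → PS
lhs₂ N = ΣPS N (λ n → (qBinom N n ⊛ qpow (n ℕ.* n)) ⊘ qPoch n
                        ⊛ ΣPS n (λ k → qpow k ⊘ ((onePS ⊖ qpow k) ⊛ (onePS ⊖ qpow k))))

rhs : ℕ → PS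
rhs N = ΣPS∞ (λ n → ((+ n • qpow n) ⊛ (onePS ⊖ qpow (N ℕ.* n))) ⊘ (onePS ⊖ qpow n))
        ⊘ qPoch N

module Submission where

-- Write [N n] for the Gaussian binomial, (q)_n for the q-Pochhammer symbol,
-- T n = n(n+1)/2 and σ j = q^j/(1-q^j)².  Dividing by (q)_N, the theorem follows
-- by adding two finite identities and comparing with a third:
--   (A) Σ_{n=1}^{N} [N n] (-1)^{n-1} n q^{T n}/(1-q^n) = Σ_{j=1}^{N} σ j (q)_j,
--   (B) Σ_{n=1}^{N} (q)_N [N n] q^{n²}/(q)_n · Σ_{k=1}^{n} σ k = Σ_{j=1}^{N} σ j (1 - (q)_j),
--   (C) Σ_{n≥1} n q^n (1-q^{Nn})/(1-q^n) = Σ_{j=1}^{N} σ j.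
-- (A) and (B) are proved by induction on N from the q-Pascal recurrences: (A) reduces
-- to the Gauss identity Σ_n (-1)^n q^{T n} [M n] = (q)_M and its differentiated form,
-- (B) to the Durfee identity Σ_n (q)_N [N n] q^{n²}/(q)_n = 1 plus summation by parts.
-- (C) expands each term as a geometric sum, exchanges the sums and shows that the
-- truncation error is O(q^{M+1}) in degree M.

open import Defs
open import Data.Nat as ℕ using (ℕ; zero; suc; z≤n; s≤s)
open import Data.Nat.DivMod using (_/_; +-distrib-/-∣ʳ; m*n/n≡m)
open import Data.Nat.Divisibility using (n∣m*n)
import Data.Nat.Solver as ℕ-Solver
import Data.Nat.Properties as ℕP
open import Data.Integer as ℤ using (ℤ; +_; -1ℤ; 1ℤ; 0ℤ)
import Data.Integer.Properties as ℤP
open import Data.Integer.Solver using (module +-*-Solver)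
open import Data.Vec using (lookup)
open import Data.Fin using (fromℕ<)
open import Data.Product using (Σ; proj₁; proj₂; _,_)
open import Data.Maybe using (Maybe; just; nothing)
open import Data.Empty using (⊥-elim)
open import Function using (_∘_)
open import Level using (0ℓ)
open import Relation.Nullary using (Dec; yes; no; ¬_)
open import Relation.Binary.PropositionalEquality as Eq using (_≡_; refl; cong; cong₂)
open import Relation.Binary.Structures using (IsEquivalence)
open import Algebra.Bundles using (CommutativeRing)
open import Algebra.Structures using (IsCommutativeRing)
import Algebra.Solver.Ring.AlmostCommutativeRing as ACR
import Algebra.Solver.Ring

Σ≤-cong : ∀ m {f g : ℕ → ℤ} → (∀ i → i ℕ.≤ m → f i ≡ g i) → Σ≤ m f ≡ Σ≤ m g
Σ≤-cong zero    h = h 0 z≤n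
Σ≤-cong (suc m) h = cong₂ ℤ._+_ (Σ≤-cong m (λ i i≤m → h i (ℕP.m≤n⇒m≤1+n i≤m))) (h (suc m) ℕP.≤-refl)

Σ≤-+ : ∀ m (f g : ℕ → ℤ) → Σ≤ m (λ i → f i ℤ.+ g i) ≡ Σ≤ m f ℤ.+ Σ≤ m g
Σ≤-+ zero    f g = refl
Σ≤-+ (suc m) f g rewrite Σ≤-+ m f g = interchange (Σ≤ m f) (Σ≤ m g) (f (suc m)) (g (suc m))
  where
  open +-*-Solver
  interchange : ∀ a b c d → (a ℤ.+ b) ℤ.+ (c ℤ.+ d) ≡ (a ℤ.+ c) ℤ.+ (b ℤ.+ d)
  interchange = solve 4 (λ a b c d → (a :+ b) :+ (c :+ d) := (a :+ c) :+ (b :+ d)) refl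

Σ≤-*ˡ : ∀ m c (f : ℕ → ℤ) → c ℤ.* Σ≤ m f ≡ Σ≤ m (λ i → c ℤ.* f i)
Σ≤-*ˡ zero    c f = refl
Σ≤-*ˡ (suc m) c f = Eq.trans (ℤP.*-distribˡ-+ c (Σ≤ m f) (f (suc m)))
                             (cong (ℤ._+ (c ℤ.* f (suc m))) (Σ≤-*ˡ m c f))

Σ≤-vanish : ∀ m (f : ℕ → ℤ) → (∀ i → i ℕ.≤ m → f i ≡ 0ℤ) → Σ≤ m f ≡ 0ℤ
Σ≤-vanish zero    f h = h 0 z≤n
Σ≤-vanish (suc m) f h = cong₂ ℤ._+_ (Σ≤-vanish m f (λ i i≤m → h i (ℕP.m≤n⇒m≤1+n i≤m))) (h (suc m) ℕP.≤-refl)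

Σ≤-head : ∀ m (f : ℕ → ℤ) → Σ≤ (suc m) f ≡ f 0 ℤ.+ Σ≤ m (f ∘ suc)
Σ≤-head zero    f = refl
Σ≤-head (suc m) f rewrite Σ≤-head m f = ℤP.+-assoc (f 0) (Σ≤ m (f ∘ suc)) (f (suc (suc m)))

Σ≤-reverse : ∀ m (f : ℕ → ℤ) → Σ≤ m f ≡ Σ≤ m (λ i → f (m ℕ.∸ i))
Σ≤-reverse zero    f = refl
Σ≤-reverse (suc m) f = begin
  Σ≤ m f ℤ.+ f (suc m)                   ≡⟨ ℤP.+-comm (Σ≤ m f) _ ⟩
  f (suc m) ℤ.+ Σ≤ m f                   ≡⟨ cong (λ x → f (suc m) ℤ.+ x) (Σ≤-reverse m f) ⟩
  f (suc m) ℤ.+ Σ≤ m (λ i → f (m ℕ.∸ i)) ≡⟨ Eq.sym (Σ≤-head m (λ i → f (suc m ℕ.∸ i))) ⟩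
  Σ≤ (suc m) (λ i → f (suc m ℕ.∸ i))     ∎
  where open Eq.≡-Reasoning

Σ≤-single : ∀ m k (f : ℕ → ℤ) → (∀ i → ¬ i ≡ k → f i ≡ 0ℤ) → k ℕ.≤ m → Σ≤ m f ≡ f k
Σ≤-single zero .zero f h z≤n = refl
Σ≤-single (suc m) k f h k≤ with k ℕ.≟ suc m
... | yes refl = Eq.trans (cong (ℤ._+ f (suc m)) below) (ℤP.+-identityˡ _)
  where below = Σ≤-vanish m f (λ i i≤m → h i (λ e → ℕP.<-irrefl e (s≤s i≤m)))
... | no k≢ = Eq.trans (cong₂ ℤ._+_ (Σ≤-single m k f h (ℕP.≤-pred (ℕP.≤∧≢⇒< k≤ k≢)))
                                    (h (suc m) (λ e → k≢ (Eq.sym e))))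
                       (ℤP.+-identityʳ _)

-- Coefficientwise equality of power series, and its record wrapper _≈_
-- (the record keeps the two sides visible to unification in setoid reasoning).

infix 4 _≐_ _≈_
_≐_ : PS → PS → Set
a ≐ b = ∀ m → a m ≡ b m

record _≈_ (a b : PS) : Set where
  constructor pw
  field at : a ≐ b
open _≈_ public

neg : PS → PS
neg a m = ℤ.- a m

shift : PS → PS
shift a m = a (suc m)

⊛-cong : ∀ {a a′ b b′} → a ≐ a′ → b ≐ b′ → a ⊛ b ≐ a′ ⊛ b′
⊛-cong p q m = Σ≤-cong m (λ i _ → cong₂ ℤ._*_ (p i) (q (m ℕ.∸ i)))

⊛-suc : ∀ a b m → (a ⊛ b) (suc m) ≡ a 0 ℤ.* b (suc m) ℤ.+ (shift a ⊛ b) m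
⊛-suc a b m = Σ≤-head m (λ i → a i ℤ.* b (suc m ℕ.∸ i))

⊛-comm : ∀ a b → a ⊛ b ≐ b ⊛ a
⊛-comm a b m = Eq.trans (Σ≤-reverse m _) (Σ≤-cong m swap)
  where
  swap : ∀ i → i ℕ.≤ m → a (m ℕ.∸ i) ℤ.* b (m ℕ.∸ (m ℕ.∸ i)) ≡ b i ℤ.* a (m ℕ.∸ i)
  swap i i≤m = Eq.trans (cong (λ k → a (m ℕ.∸ i) ℤ.* b k) (ℕP.m∸[m∸n]≡n i≤m)) (ℤP.*-comm (a (m ℕ.∸ i)) (b i))

⊛-distribˡ : ∀ a b c → a ⊛ (b ⊕ c) ≐ a ⊛ b ⊕ a ⊛ c
⊛-distribˡ a b c m = Eq.trans (Σ≤-cong m (λ i _ → ℤP.*-distribˡ-+ (a i) (b (m ℕ.∸ i)) (c (m ℕ.∸ i)))) (Σ≤-+ m _ _)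

⊛-distribʳ : ∀ a b c → (b ⊕ c) ⊛ a ≐ b ⊛ a ⊕ c ⊛ a
⊛-distribʳ a b c m = Eq.trans (Σ≤-cong m (λ i _ → ℤP.*-distribʳ-+ (a (m ℕ.∸ i)) (b i) (c i))) (Σ≤-+ m _ _)

•-⊛ : ∀ c a b → (c • a) ⊛ b ≐ c • (a ⊛ b)
•-⊛ c a b m = Eq.trans (Σ≤-cong m (λ i _ → ℤP.*-assoc c (a i) (b (m ℕ.∸ i)))) (Eq.sym (Σ≤-*ˡ m c _))

-- Associativity by induction on the degree, peeling off the constant term of a ⊛ b.
⊛-assoc : ∀ m a b c → ((a ⊛ b) ⊛ c) m ≡ (a ⊛ (b ⊛ c)) m
⊛-assoc zero    a b c = ℤP.*-assoc (a 0) (b 0) (c 0)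
⊛-assoc (suc m) a b c = begin
  ((a ⊛ b) ⊛ c) (suc m)
    ≡⟨ ⊛-suc (a ⊛ b) c m ⟩
  (a 0 ℤ.* b 0) ℤ.* c (suc m) ℤ.+ (shift (a ⊛ b) ⊛ c) m
    ≡⟨ cong (λ x → (a 0 ℤ.* b 0) ℤ.* c (suc m) ℤ.+ x)
            (Eq.trans (⊛-cong {shift (a ⊛ b)} {(a 0 • shift b) ⊕ (shift a ⊛ b)} {c} {c} (⊛-suc a b) (λ _ → refl) m) (⊛-distribʳ c (a 0 • shift b) (shift a ⊛ b) m)) ⟩
  (a 0 ℤ.* b 0) ℤ.* c (suc m) ℤ.+ (((a 0 • shift b) ⊛ c) m ℤ.+ ((shift a ⊛ b) ⊛ c) m)
    ≡⟨ cong₂ (λ x y → (a 0 ℤ.* b 0) ℤ.* c (suc m) ℤ.+ (x ℤ.+ y)) (•-⊛ (a 0) (shift b) c m) (⊛-assoc m (shift a) b c) ⟩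
  (a 0 ℤ.* b 0) ℤ.* c (suc m) ℤ.+ (a 0 ℤ.* (shift b ⊛ c) m ℤ.+ (shift a ⊛ (b ⊛ c)) m)
    ≡⟨ regroup (a 0) (b 0) (c (suc m)) ((shift b ⊛ c) m) ((shift a ⊛ (b ⊛ c)) m) ⟩
  a 0 ℤ.* (b 0 ℤ.* c (suc m) ℤ.+ (shift b ⊛ c) m) ℤ.+ (shift a ⊛ (b ⊛ c)) m
    ≡⟨ cong (λ x → a 0 ℤ.* x ℤ.+ (shift a ⊛ (b ⊛ c)) m) (Eq.sym (⊛-suc b c m)) ⟩
  a 0 ℤ.* (b ⊛ c) (suc m) ℤ.+ (shift a ⊛ (b ⊛ c)) m
    ≡⟨ Eq.sym (⊛-suc a (b ⊛ c) m) ⟩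
  (a ⊛ (b ⊛ c)) (suc m) ∎
  where
  open Eq.≡-Reasoning
  open +-*-Solver
  regroup : ∀ x y z u v → (x ℤ.* y) ℤ.* z ℤ.+ (x ℤ.* u ℤ.+ v) ≡ x ℤ.* (y ℤ.* z ℤ.+ u) ℤ.+ v
  regroup = solve 5 (λ x y z u v → (x :* y) :* z :+ (x :* u :+ v) := x :* (y :* z :+ u) :+ v) refl

onePS-⊛ : ∀ a → onePS ⊛ a ≐ a
onePS-⊛ a m = Eq.trans (Σ≤-single m 0 _ off-zero z≤n) (ℤP.*-identityˡ (a m))
  where
  off-zero : ∀ i → ¬ i ≡ 0 → onePS i ℤ.* a (m ℕ.∸ i) ≡ 0ℤ
  off-zero zero    ne = ⊥-elim (ne refl)
  off-zero (suc i) ne = refl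

-- Coefficient m+1 of inv a is  -Σ_{j=0}^{m} a (j+1) · inv a (m-j);
-- Defs computes it from a table of the earlier coefficients, whose lookup
-- function `inv-table` exposes so that it can be evaluated.

invVec-lookup : ∀ a m j (p : j ℕ.< suc m) → lookup (invVec a m) (fromℕ< p) ≡ inv a (m ℕ.∸ j)
invVec-lookup a zero    zero    (s≤s z≤n) = refl
invVec-lookup a (suc m) zero    p         = refl
invVec-lookup a (suc m) (suc j) (s≤s p)   = invVec-lookup a m j p

inv-table : ∀ a m → Σ (ℕ → ℤ) λ look → inv a (suc m) ≡ ℤ.- Σ≤ m (λ j → a (suc j) ℤ.* look j)
inv-table a m = _ , refl

inv-table-lookup : ∀ a m j → j ℕ.≤ m → proj₁ (inv-table a m) j ≡ inv a (m ℕ.∸ j)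
inv-table-lookup a m j j≤m with j ℕ.<? suc m
... | yes p = invVec-lookup a m j p
... | no ¬p = ⊥-elim (¬p (s≤s j≤m))

inv-suc : ∀ a m → inv a (suc m) ≡ ℤ.- Σ≤ m (λ j → a (suc j) ℤ.* inv a (m ℕ.∸ j))
inv-suc a m = Eq.trans (proj₂ (inv-table a m))
  (cong ℤ.-_ (Σ≤-cong m (λ j j≤m → cong (a (suc j) ℤ.*_) (inv-table-lookup a m j j≤m))))

inv-inverseʳ-coeff : ∀ a → a 0 ≡ 1ℤ → a ⊛ inv a ≐ onePS
inv-inverseʳ-coeff a a0≡1 zero rewrite a0≡1 = refl
inv-inverseʳ-coeff a a0≡1 (suc m) = begin
  (a ⊛ inv a) (suc m)             ≡⟨ ⊛-suc a (inv a) m ⟩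
  a 0 ℤ.* inv a (suc m) ℤ.+ X     ≡⟨ cong₂ (λ u v → u ℤ.* v ℤ.+ X) a0≡1 (inv-suc a m) ⟩
  1ℤ ℤ.* (ℤ.- X) ℤ.+ X            ≡⟨ cong (ℤ._+ X) (ℤP.*-identityˡ (ℤ.- X)) ⟩
  ℤ.- X ℤ.+ X                     ≡⟨ ℤP.+-inverseˡ X ⟩
  0ℤ                              ∎
  where
  open Eq.≡-Reasoning
  X = (shift a ⊛ inv a) m

qpow-diag : ∀ k → qpow k k ≡ 1ℤ
qpow-diag k with k ℕ.≟ k
... | yes _ = refl
... | no ne = ⊥-elim (ne refl)

qpow-off : ∀ k i → ¬ k ≡ i → qpow k i ≡ 0ℤ
qpow-off k i ne with k ℕ.≟ i
... | yes e = ⊥-elim (ne e)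
... | no _  = refl

qpow-⊛ : ∀ k a m → k ℕ.≤ m → (qpow k ⊛ a) m ≡ a (m ℕ.∸ k)
qpow-⊛ k a m k≤m =
  Eq.trans (Σ≤-single m k _ (λ i ne → cong (ℤ._* a (m ℕ.∸ i)) (qpow-off k i (λ e → ne (Eq.sym e)))) k≤m)
           (Eq.trans (cong (ℤ._* a (m ℕ.∸ k)) (qpow-diag k)) (ℤP.*-identityˡ _))

qpow-⊛-below : ∀ k a m → m ℕ.< k → (qpow k ⊛ a) m ≡ 0ℤ
qpow-⊛-below k a m m<k = Σ≤-vanish m _ (λ i i≤m → cong (ℤ._* a (m ℕ.∸ i)) (qpow-off k i (k≢i i≤m)))
  where
  k≢i : ∀ {i} → i ℕ.≤ m → ¬ k ≡ i
  k≢i i≤m refl = ℕP.<-irrefl refl (ℕP.<-≤-trans m<k i≤m)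

qpow-add : ∀ j k → qpow (j ℕ.+ k) ≐ qpow j ⊛ qpow k
qpow-add j k m with j ℕ.≤? m
... | yes j≤m = Eq.sym (Eq.trans (qpow-⊛ j (qpow k) m j≤m) (compare (j ℕ.+ k ℕ.≟ m)))
  where
  compare : Dec (j ℕ.+ k ≡ m) → qpow k (m ℕ.∸ j) ≡ qpow (j ℕ.+ k) m
  compare (yes refl) rewrite ℕP.m+n∸m≡n j k = Eq.trans (qpow-diag k) (Eq.sym (qpow-diag (j ℕ.+ k)))
  compare (no ne) = Eq.trans (qpow-off k (m ℕ.∸ j) (λ e → ne (Eq.trans (cong (j ℕ.+_) e) (ℕP.m+[n∸m]≡n j≤m))))
                             (Eq.sym (qpow-off (j ℕ.+ k) m ne))
... | no j≰m = Eq.trans (qpow-off (j ℕ.+ k) m (λ e → j≰m (Eq.subst (j ℕ.≤_) e (ℕP.m≤m+n j k))))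
                        (Eq.sym (qpow-⊛-below j (qpow k) m (ℕP.≰⇒> j≰m)))

≈-isEquivalence : IsEquivalence _≈_
≈-isEquivalence = record
  { refl  = pw (λ _ → refl)
  ; sym   = λ p → pw (λ m → Eq.sym (at p m))
  ; trans = λ p q → pw (λ m → Eq.trans (at p m) (at q m)) }

PS-isCommutativeRing : IsCommutativeRing _≈_ _⊕_ _⊛_ neg zeroPS onePS
PS-isCommutativeRing = record
  { isRing = record
    { +-isAbelianGroup = record
      { isGroup = record
        { isMonoid = record
          { isSemigroup = record
            { isMagma = record
              { isEquivalence = ≈-isEquivalence
              ; ∙-cong = λ p q → pw (λ m → cong₂ ℤ._+_ (at p m) (at q m)) }
            ; assoc = λ a b c → pw (λ m → ℤP.+-assoc (a m) (b m) (c m)) }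
          ; identity = (λ a → pw (λ m → ℤP.+-identityˡ (a m))) , (λ a → pw (λ m → ℤP.+-identityʳ (a m))) }
        ; inverse = (λ a → pw (λ m → ℤP.+-inverseˡ (a m))) , (λ a → pw (λ m → ℤP.+-inverseʳ (a m)))
        ; ⁻¹-cong = λ p → pw (λ m → cong ℤ.-_ (at p m)) }
      ; comm = λ a b → pw (λ m → ℤP.+-comm (a m) (b m)) }
    ; *-cong = λ p q → pw (⊛-cong (at p) (at q))
    ; *-assoc = λ a b c → pw (λ m → ⊛-assoc m a b c)
    ; *-identity = (λ a → pw (onePS-⊛ a)) , (λ a → pw (λ m → Eq.trans (⊛-comm a onePS m) (onePS-⊛ a m)))
    ; distrib = (λ a b c → pw (⊛-distribˡ a b c)) , (λ a b c → pw (⊛-distribʳ a b c)) }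
  ; *-comm = λ a b → pw (⊛-comm a b) }

PSRing : CommutativeRing 0ℓ 0ℓ
PSRing = record { isCommutativeRing = PS-isCommutativeRing }

-- Integer constants embed as a ring morphism ℤ → ℤ[[q]]; this makes the
-- commutative-ring solver available for identities between power series.

cst : ℤ → PS
cst c = c • onePS

cst-morphism : CommutativeRing.rawRing ℤP.+-*-commutativeRing ACR.-Raw-AlmostCommutative⟶ ACR.fromCommutativeRing PSRing
cst-morphism = record
  { ⟦_⟧    = cst
  ; +-homo = λ a b → pw (λ m → ℤP.*-distribʳ-+ (onePS m) a b)
  ; *-homo = λ a b → pw (λ m → Eq.trans (ℤP.*-assoc a b (onePS m))
                                        (Eq.sym (Eq.trans (•-⊛ a onePS (cst b) m) (cong (a ℤ.*_) (onePS-⊛ (cst b) m)))))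
  ; -‿homo = λ a → pw (λ m → Eq.sym (ℤP.neg-distribˡ-* a (onePS m)))
  ; 0-homo = pw (λ m → refl)
  ; 1-homo = pw (λ m → ℤP.*-identityˡ (onePS m)) }

cst-≟ : ∀ x y → Maybe (cst x ≈ cst y)
cst-≟ x y with x ℤ.≟ y
... | yes refl = just (pw (λ _ → refl))
... | no _     = nothing

module PS-Solver = Algebra.Solver.Ring (CommutativeRing.rawRing ℤP.+-*-commutativeRing)
                                       (ACR.fromCommutativeRing PSRing) cst-morphism cst-≟

open CommutativeRing PSRing public
  using (+-cong; *-cong; +-assoc; *-assoc; *-comm; setoid)
  renaming (refl to ≈-refl; sym to ≈-sym; trans to ≈-trans;
            *-identityˡ to ⊛-identityˡ; *-identityʳ to ⊛-identityʳ)
open import Relation.Binary.Reasoning.Setoid setoid public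
open PS-Solver public using (solve; _:=_; _:+_; _:*_; _:-_; :-_; con)

-- Congruence in infix form, and reflexivity at an explicitly given series
-- (⊕ and ⊛ are not injective, so the series cannot be inferred from the goal).

infixl 7 _⟨⊛⟩_
infixl 6 _⟨⊕⟩_ _⟨⊖⟩_

_⟨⊛⟩_ : ∀ {x y u v} → x ≈ y → u ≈ v → x ⊛ u ≈ y ⊛ v
_⟨⊛⟩_ = *-cong

_⟨⊕⟩_ : ∀ {x y u v} → x ≈ y → u ≈ v → x ⊕ u ≈ y ⊕ v
_⟨⊕⟩_ = +-cong

_⟨⊖⟩_ : ∀ {x y u v} → x ≈ y → u ≈ v → x ⊖ u ≈ y ⊖ v
p ⟨⊖⟩ q = pw (λ m → cong₂ ℤ._-_ (at p m) (at q m))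

rfl : ∀ x → x ≈ x
rfl x = ≈-refl

inv-inverseʳ : ∀ a → a 0 ≡ 1ℤ → a ⊛ inv a ≈ onePS
inv-inverseʳ a a0≡1 = pw (inv-inverseʳ-coeff a a0≡1)

inv-inverseˡ : ∀ a → a 0 ≡ 1ℤ → inv a ⊛ a ≈ onePS
inv-inverseˡ a a0≡1 = ≈-trans (*-comm (inv a) a) (inv-inverseʳ a a0≡1)

⊛-cancelʳ : ∀ c x y → c 0 ≡ 1ℤ → x ⊛ c ≈ y ⊛ c → x ≈ y
⊛-cancelʳ c x y c0≡1 e = begin
  x                  ≈⟨ ≈-sym (⊛-identityʳ x) ⟩
  x ⊛ onePS          ≈⟨ rfl x ⟨⊛⟩ ≈-sym (inv-inverseʳ c c0≡1) ⟩
  x ⊛ (c ⊛ inv c)    ≈⟨ ≈-sym (*-assoc x c (inv c)) ⟩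
  (x ⊛ c) ⊛ inv c    ≈⟨ e ⟨⊛⟩ rfl (inv c) ⟩
  (y ⊛ c) ⊛ inv c    ≈⟨ *-assoc y c (inv c) ⟩
  y ⊛ (c ⊛ inv c)    ≈⟨ rfl y ⟨⊛⟩ inv-inverseʳ c c0≡1 ⟩
  y ⊛ onePS          ≈⟨ ⊛-identityʳ y ⟩
  y                  ∎

inv-unique : ∀ a b → a 0 ≡ 1ℤ → a ⊛ b ≈ onePS → inv a ≈ b
inv-unique a b a0≡1 e = ⊛-cancelʳ a (inv a) b a0≡1
  (≈-trans (inv-inverseˡ a a0≡1) (≈-trans (≈-sym e) (*-comm a b)))

⊛-const : ∀ a b → a 0 ≡ 1ℤ → b 0 ≡ 1ℤ → (a ⊛ b) 0 ≡ 1ℤ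
⊛-const a b a0≡1 b0≡1 = cong₂ ℤ._*_ a0≡1 b0≡1

inv-⊛ : ∀ a b → a 0 ≡ 1ℤ → b 0 ≡ 1ℤ → inv (a ⊛ b) ≈ inv a ⊛ inv b
inv-⊛ a b a0≡1 b0≡1 = inv-unique (a ⊛ b) (inv a ⊛ inv b) (⊛-const a b a0≡1 b0≡1) (begin
  (a ⊛ b) ⊛ (inv a ⊛ inv b)
    ≈⟨ solve 4 (λ a b x y → (a :* b) :* (x :* y) := (a :* x) :* (b :* y)) ≈-refl a b (inv a) (inv b) ⟩
  (a ⊛ inv a) ⊛ (b ⊛ inv b) ≈⟨ inv-inverseʳ a a0≡1 ⟨⊛⟩ inv-inverseʳ b b0≡1 ⟩
  onePS ⊛ onePS             ≈⟨ ⊛-identityˡ onePS ⟩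
  onePS                     ∎)


Q : ℕ → PS
Q = qpow

U : ℕ → PS
U k = onePS ⊖ qpow k

W : ℕ → PS
W k = inv (U k)

P : ℕ → PS
P = qPoch

J : ℕ → PS
J n = inv (qPoch n)

P-const : ∀ n → P n 0 ≡ 1ℤ
P-const zero    = refl
P-const (suc n) = cong (ℤ._* 1ℤ) (P-const n)

≡⇒≈ : ∀ {a b} → a ≡ b → a ≈ b
≡⇒≈ refl = ≈-refl

Q-cong : ∀ {j k} → j ≡ k → Q j ≈ Q k
Q-cong e = ≡⇒≈ (cong Q e)

Q-add : ∀ j k → Q (j ℕ.+ k) ≈ Q j ⊛ Q k
Q-add j k = pw (qpow-add j k)

Q-zero : Q 0 ≈ onePS
Q-zero = pw coeff
  where
  coeff : ∀ m → qpow 0 m ≡ onePS m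
  coeff zero    = qpow-diag 0
  coeff (suc m) = qpow-off 0 (suc m) (λ ())

-- Writing 1 as the constant cst 1ℤ lets the solver see it.
onePS≈cst : onePS ≈ cst 1ℤ
onePS≈cst = pw (λ m → Eq.sym (ℤP.*-identityˡ (onePS m)))

U≈cst : ∀ k → U k ≈ cst 1ℤ ⊖ Q k
U≈cst k = onePS≈cst ⟨⊖⟩ rfl (Q k)

•≈cst : ∀ c x → c • x ≈ cst c ⊛ x
•≈cst c x = ≈-sym (pw (λ m → Eq.trans (•-⊛ c onePS x m) (cong (c ℤ.*_) (onePS-⊛ x m))))

cst-* : ∀ a c → cst (a ℤ.* c) ≈ cst a ⊛ cst c
cst-* = ACR._-Raw-AlmostCommutative⟶_.*-homo cst-morphism

cst-suc : ∀ i → cst (+ suc i) ≈ cst 1ℤ ⊕ cst (+ i)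
cst-suc i = pw (λ m → ℤP.*-distribʳ-+ (onePS m) 1ℤ (+ i))

U-split : ∀ x y z → Q z ≈ Q x ⊛ Q y → U z ≈ U x ⊕ Q x ⊛ U y
U-split x y z e = begin
  U z                                   ≈⟨ U≈cst z ⟩
  cst 1ℤ ⊖ Q z                          ≈⟨ rfl (cst 1ℤ) ⟨⊖⟩ e ⟩
  cst 1ℤ ⊖ Q x ⊛ Q y
    ≈⟨ solve 2 (λ a c → con 1ℤ :- a :* c := (con 1ℤ :- a) :+ a :* (con 1ℤ :- c)) ≈-refl (Q x) (Q y) ⟩
  (cst 1ℤ ⊖ Q x) ⊕ Q x ⊛ (cst 1ℤ ⊖ Q y) ≈⟨ ≈-sym (U≈cst x ⟨⊕⟩ rfl (Q x) ⟨⊛⟩ U≈cst y) ⟩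
  U x ⊕ Q x ⊛ U y                       ∎

U-W : ∀ k → U (suc k) ⊛ W (suc k) ≈ onePS
U-W k = inv-inverseʳ (U (suc k)) refl

W-U : ∀ k → W (suc k) ⊛ U (suc k) ≈ onePS
W-U k = inv-inverseˡ (U (suc k)) refl

P-J : ∀ n → P n ⊛ J n ≈ onePS
P-J n = inv-inverseʳ (P n) (P-const n)

J-P : ∀ n → J n ⊛ P n ≈ onePS
J-P n = inv-inverseˡ (P n) (P-const n)

J-zero : J 0 ≈ onePS
J-zero = inv-unique onePS onePS refl (⊛-identityˡ onePS)

J-suc : ∀ n → J (suc n) ≈ J n ⊛ W (suc n)
J-suc n = inv-⊛ (P n) (U (suc n)) (P-const n) refl

J-U : ∀ i → J (suc i) ⊛ U (suc i) ≈ J i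
J-U i = begin
  J (suc i) ⊛ U (suc i)        ≈⟨ J-suc i ⟨⊛⟩ rfl (U (suc i)) ⟩
  J i ⊛ W (suc i) ⊛ U (suc i)  ≈⟨ *-assoc (J i) (W (suc i)) (U (suc i)) ⟩
  J i ⊛ (W (suc i) ⊛ U (suc i)) ≈⟨ rfl (J i) ⟨⊛⟩ W-U i ⟩
  J i ⊛ onePS                  ≈⟨ ⊛-identityʳ (J i) ⟩
  J i                          ∎

ΣPS-cong : ∀ N f g → (∀ i → i ℕ.< N → f (suc i) ≈ g (suc i)) → ΣPS N f ≈ ΣPS N g
ΣPS-cong zero    f g h = ≈-refl
ΣPS-cong (suc N) f g h = +-cong (ΣPS-cong N f g (λ i i<N → h i (ℕP.m<n⇒m<1+n i<N))) (h N ℕP.≤-refl)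

ΣPS-⊕ : ∀ N f g → ΣPS N (λ n → f n ⊕ g n) ≈ ΣPS N f ⊕ ΣPS N g
ΣPS-⊕ zero    f g = pw (λ m → refl)
ΣPS-⊕ (suc N) f g = ≈-trans (ΣPS-⊕ N f g ⟨⊕⟩ rfl (f (suc N) ⊕ g (suc N)))
  (solve 4 (λ a b c d → (a :+ b) :+ (c :+ d) := (a :+ c) :+ (b :+ d)) ≈-refl (ΣPS N f) (ΣPS N g) (f (suc N)) (g (suc N)))

ΣPS-⊖ : ∀ N f g → ΣPS N (λ n → f n ⊖ g n) ≈ ΣPS N f ⊖ ΣPS N g
ΣPS-⊖ zero    f g = pw (λ m → refl)
ΣPS-⊖ (suc N) f g = ≈-trans (ΣPS-⊖ N f g ⟨⊕⟩ rfl (f (suc N) ⊖ g (suc N)))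
  (solve 4 (λ a b c d → (a :- b) :+ (c :- d) := (a :+ c) :- (b :+ d)) ≈-refl (ΣPS N f) (ΣPS N g) (f (suc N)) (g (suc N)))

ΣPS-⊛ˡ : ∀ N c f → c ⊛ ΣPS N f ≈ ΣPS N (λ n → c ⊛ f n)
ΣPS-⊛ˡ zero    c f = pw (λ m → Σ≤-vanish m _ (λ i _ → ℤP.*-zeroʳ (c i)))
ΣPS-⊛ˡ (suc N) c f = ≈-trans (pw (⊛-distribˡ c (ΣPS N f) (f (suc N)))) (ΣPS-⊛ˡ N c f ⟨⊕⟩ rfl (c ⊛ f (suc N)))

ΣPS-telescope : ∀ N (f : ℕ → PS) → ΣPS N (λ n → f (n ℕ.∸ 1) ⊖ f n) ≈ f 0 ⊖ f N
ΣPS-telescope zero    f = pw (λ m → Eq.sym (ℤP.+-inverseʳ (f 0 m)))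
ΣPS-telescope (suc N) f = ≈-trans (ΣPS-telescope N f ⟨⊕⟩ rfl (f N ⊖ f (suc N)))
  (solve 3 (λ a c d → (a :- c) :+ (c :- d) := a :- d) ≈-refl (f 0) (f N) (f (suc N)))

Σ₀ : ℕ → (ℕ → PS) → PS
Σ₀ N f = f 0 ⊕ ΣPS N f

Σ₀-shift : ∀ N (f : ℕ → PS) → ΣPS N (λ n → f (n ℕ.∸ 1)) ⊕ f N ≈ Σ₀ N f
Σ₀-shift zero    f = pw (λ m → ℤP.+-comm 0ℤ (f 0 m))
Σ₀-shift (suc N) f = begin
  (X ⊕ f N) ⊕ f (suc N)   ≈⟨ Σ₀-shift N f ⟨⊕⟩ rfl (f (suc N)) ⟩
  (f 0 ⊕ ΣPS N f) ⊕ f (suc N) ≈⟨ +-assoc (f 0) (ΣPS N f) (f (suc N)) ⟩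
  Σ₀ (suc N) f            ∎
  where X = ΣPS N (λ n → f (n ℕ.∸ 1))

summation-by-parts : ∀ M (E s : ℕ → PS) →
  ΣPS M (λ n → (E n ⊖ E (suc n)) ⊛ ΣPS n s) ⊕ E (suc M) ⊛ ΣPS M s ≈ ΣPS M (λ n → E n ⊛ s n)
summation-by-parts zero    E s = pw (λ m → cong (λ x → 0ℤ ℤ.+ x) (Σ≤-vanish m _ (λ i _ → ℤP.*-zeroʳ (E 1 i))))
summation-by-parts (suc M) E s = begin
  (A ⊕ (E (suc M) ⊖ E (suc (suc M))) ⊛ (SM ⊕ s (suc M))) ⊕ E (suc (suc M)) ⊛ (SM ⊕ s (suc M))
    ≈⟨ solve 5 (λ a e₁ e₂ sm x → (a :+ (e₁ :- e₂) :* (sm :+ x)) :+ e₂ :* (sm :+ x) := (a :+ e₁ :* sm) :+ e₁ :* x)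
             ≈-refl A (E (suc M)) (E (suc (suc M))) SM (s (suc M)) ⟩
  (A ⊕ E (suc M) ⊛ SM) ⊕ E (suc M) ⊛ s (suc M) ≈⟨ summation-by-parts M E s ⟨⊕⟩ rfl (E (suc M) ⊛ s (suc M)) ⟩
  ΣPS (suc M) (λ n → E n ⊛ s n)                 ∎
  where
  A  = ΣPS M (λ n → (E n ⊖ E (suc n)) ⊛ ΣPS n s)
  SM = ΣPS M s

ΣPS-swap : ∀ M N (g : ℕ → ℕ → PS) → ΣPS M (λ n → ΣPS N (g n)) ≈ ΣPS N (λ j → ΣPS M (λ n → g n j))
ΣPS-swap zero    N g = ≈-sym (vanish N)
  where
  vanish : ∀ N → ΣPS N (λ _ → zeroPS) ≈ zeroPS
  vanish zero    = ≈-refl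
  vanish (suc N) = pw (λ m → Eq.trans (ℤP.+-identityʳ _) (at (vanish N) m))
ΣPS-swap (suc M) N g = ≈-trans (ΣPS-swap M N g ⟨⊕⟩ rfl (ΣPS N (g (suc M)))) (≈-sym (ΣPS-⊕ N (λ j → ΣPS M (λ n → g n j)) (g (suc M))))

split< : ∀ i M → i ℕ.< M → Σ ℕ λ k → M ≡ suc (i ℕ.+ k)
split< i (suc M) (s≤s i≤M) = M ℕ.∸ i , cong suc (Eq.sym (ℕP.m+[n∸m]≡n i≤M))

split≤ : ∀ i M → i ℕ.≤ M → Σ ℕ λ k → M ≡ i ℕ.+ k
split≤ i M i≤M = M ℕ.∸ i , Eq.sym (ℕP.m+[n∸m]≡n i≤M)

1+i+k∸i : ∀ i k → suc (i ℕ.+ k) ℕ.∸ i ≡ suc k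
1+i+k∸i i k = Eq.trans (cong (ℕ._∸ i) (Eq.sym (ℕP.+-suc i k))) (ℕP.m+n∸m≡n i (suc k))

2+i+k≡1+k+1+i : ∀ i k → suc (suc (i ℕ.+ k)) ≡ suc k ℕ.+ suc i
2+i+k≡1+k+1+i i k = cong suc (Eq.trans (cong suc (ℕP.+-comm i k)) (Eq.sym (ℕP.+-suc k i)))

binom : ℕ → ℕ → PS
binom N n = P N ⊛ (J n ⊛ J (N ℕ.∸ n))

qBinom≈binom : ∀ N n → qBinom N n ≈ binom N n
qBinom≈binom N n = rfl (P N) ⟨⊛⟩ inv-⊛ (P n) (P (N ℕ.∸ n)) (P-const n) (P-const (N ℕ.∸ n))

P⊛P-const : ∀ n r → (P n ⊛ P r) 0 ≡ 1ℤ
P⊛P-const n r = ⊛-const (P n) (P r) (P-const n) (P-const r)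

binom-P : ∀ N n r → N ℕ.∸ n ≡ r → binom N n ⊛ (P n ⊛ P r) ≈ P N
binom-P N n r refl = begin
  P N ⊛ (J n ⊛ J r) ⊛ (P n ⊛ P r)
    ≈⟨ solve 5 (λ p a b x y → p :* (a :* b) :* (x :* y) := p :* ((a :* x) :* (b :* y))) ≈-refl (P N) (J n) (J r) (P n) (P r) ⟩
  P N ⊛ ((J n ⊛ P n) ⊛ (J r ⊛ P r)) ≈⟨ rfl (P N) ⟨⊛⟩ (J-P n ⟨⊛⟩ J-P r) ⟩
  P N ⊛ (onePS ⊛ onePS)             ≈⟨ rfl (P N) ⟨⊛⟩ ⊛-identityˡ onePS ⟩
  P N ⊛ onePS                       ≈⟨ ⊛-identityʳ (P N) ⟩
  P N                               ∎

binom-char : ∀ N n r x → N ℕ.∸ n ≡ r → x ⊛ (P n ⊛ P r) ≈ P N → x ≈ binom N n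
binom-char N n r x e h = ⊛-cancelʳ (P n ⊛ P r) x (binom N n) (P⊛P-const n r) (≈-trans h (≈-sym (binom-P N n r e)))

binom-zero : ∀ N → binom N 0 ≈ onePS
binom-zero N = ≈-sym (binom-char N 0 N onePS refl (≈-trans (⊛-identityˡ _) (⊛-identityˡ (P N))))

binom-diag : ∀ N → binom N N ≈ onePS
binom-diag N = ≈-sym (binom-char N N 0 onePS (ℕP.n∸n≡0 N) (≈-trans (⊛-identityˡ _) (⊛-identityʳ (P N))))

-- Both follow from 1 - q^{M+1} = (1 - q^a) + q^a (1 - q^b) with {a, b} = {k+1, i+1}.
module _ (i k : ℕ) where
  private
    M  = suc (i ℕ.+ k)
    B₁ = binom M (suc i)
    B₀ = binom M i
    B₁-P : B₁ ⊛ (P (suc i) ⊛ P k) ≈ P M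
    B₁-P = binom-P M (suc i) k (ℕP.m+n∸m≡n i k)
    B₀-P : B₀ ⊛ (P i ⊛ P (suc k)) ≈ P M
    B₀-P = binom-P M i (suc k) (1+i+k∸i i k)

  binom-pascal₁ : binom (suc M) (suc i) ≈ B₁ ⊕ Q (suc k) ⊛ B₀
  binom-pascal₁ = ≈-sym (binom-char (suc M) (suc i) (suc k) _ (1+i+k∸i i k) (begin
    (B₁ ⊕ Q (suc k) ⊛ B₀) ⊛ ((P i ⊛ U (suc i)) ⊛ (P k ⊛ U (suc k)))
      ≈⟨ solve 7 (λ b₁ b₀ q pi ui pk uk → (b₁ :+ q :* b₀) :* ((pi :* ui) :* (pk :* uk))
                   := (b₁ :* ((pi :* ui) :* pk)) :* uk :+ (q :* ui) :* (b₀ :* (pi :* (pk :* uk)))) ≈-refl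
           B₁ B₀ (Q (suc k)) (P i) (U (suc i)) (P k) (U (suc k)) ⟩
    (B₁ ⊛ (P (suc i) ⊛ P k)) ⊛ U (suc k) ⊕ (Q (suc k) ⊛ U (suc i)) ⊛ (B₀ ⊛ (P i ⊛ P (suc k)))
      ≈⟨ B₁-P ⟨⊛⟩ rfl (U (suc k)) ⟨⊕⟩ rfl (Q (suc k) ⊛ U (suc i)) ⟨⊛⟩ B₀-P ⟩
    P M ⊛ U (suc k) ⊕ (Q (suc k) ⊛ U (suc i)) ⊛ P M
      ≈⟨ solve 4 (λ p u q v → p :* u :+ (q :* v) :* p := p :* (u :+ q :* v)) ≈-refl (P M) (U (suc k)) (Q (suc k)) (U (suc i)) ⟩
    P M ⊛ (U (suc k) ⊕ Q (suc k) ⊛ U (suc i))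
      ≈⟨ rfl (P M) ⟨⊛⟩ ≈-sym (U-split (suc k) (suc i) (suc M) (≈-trans (Q-cong (2+i+k≡1+k+1+i i k)) (Q-add (suc k) (suc i)))) ⟩
    P M ⊛ U (suc M) ∎))

  binom-pascal₂ : binom (suc M) (suc i) ≈ Q (suc i) ⊛ B₁ ⊕ B₀
  binom-pascal₂ = ≈-sym (binom-char (suc M) (suc i) (suc k) _ (1+i+k∸i i k) (begin
    (Q (suc i) ⊛ B₁ ⊕ B₀) ⊛ ((P i ⊛ U (suc i)) ⊛ (P k ⊛ U (suc k)))
      ≈⟨ solve 7 (λ b₁ b₀ q pi ui pk uk → (q :* b₁ :+ b₀) :* ((pi :* ui) :* (pk :* uk))
                   := (q :* uk) :* (b₁ :* ((pi :* ui) :* pk)) :+ ui :* (b₀ :* (pi :* (pk :* uk)))) ≈-refl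
           B₁ B₀ (Q (suc i)) (P i) (U (suc i)) (P k) (U (suc k)) ⟩
    (Q (suc i) ⊛ U (suc k)) ⊛ (B₁ ⊛ (P (suc i) ⊛ P k)) ⊕ U (suc i) ⊛ (B₀ ⊛ (P i ⊛ P (suc k)))
      ≈⟨ rfl (Q (suc i) ⊛ U (suc k)) ⟨⊛⟩ B₁-P ⟨⊕⟩ rfl (U (suc i)) ⟨⊛⟩ B₀-P ⟩
    (Q (suc i) ⊛ U (suc k)) ⊛ P M ⊕ U (suc i) ⊛ P M
      ≈⟨ solve 4 (λ p u q v → (q :* u) :* p :+ v :* p := p :* (v :+ q :* u)) ≈-refl (P M) (U (suc k)) (Q (suc i)) (U (suc i)) ⟩
    P M ⊛ (U (suc i) ⊕ Q (suc i) ⊛ U (suc k))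
      ≈⟨ rfl (P M) ⟨⊛⟩ ≈-sym (U-split (suc i) (suc k) (suc M)
           (≈-trans (Q-cong (Eq.trans (2+i+k≡1+k+1+i i k) (ℕP.+-comm (suc k) (suc i)))) (Q-add (suc i) (suc k)))) ⟩
    P M ⊛ U (suc M) ∎))

binom-absorb : ∀ M i → i ℕ.≤ M → binom M i ⊛ U (suc M) ≈ binom (suc M) (suc i) ⊛ U (suc i)
binom-absorb M i i≤M with split≤ i M i≤M
... | k , refl = ⊛-cancelʳ (P i ⊛ P k) _ _ (P⊛P-const i k) (begin
  binom M i ⊛ U (suc M) ⊛ (P i ⊛ P k)
    ≈⟨ solve 4 (λ x u p r → x :* u :* (p :* r) := x :* (p :* r) :* u) ≈-refl (binom M i) (U (suc M)) (P i) (P k) ⟩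
  binom M i ⊛ (P i ⊛ P k) ⊛ U (suc M) ≈⟨ binom-P M i k (ℕP.m+n∸m≡n i k) ⟨⊛⟩ rfl (U (suc M)) ⟩
  P (suc M)                           ≈⟨ ≈-sym (binom-P (suc M) (suc i) k (ℕP.m+n∸m≡n i k)) ⟩
  binom (suc M) (suc i) ⊛ (P i ⊛ U (suc i) ⊛ P k)
    ≈⟨ solve 4 (λ x p u r → x :* (p :* u :* r) := x :* u :* (p :* r)) ≈-refl (binom (suc M) (suc i)) (P i) (U (suc i)) (P k) ⟩
  binom (suc M) (suc i) ⊛ U (suc i) ⊛ (P i ⊛ P k) ∎)

binom-absorb-W : ∀ M i → i ℕ.≤ M → binom M i ⊛ W (suc i) ≈ W (suc M) ⊛ binom (suc M) (suc i)
binom-absorb-W M i i≤M = begin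
  x ⊛ w               ≈⟨ ≈-sym (⊛-identityʳ (x ⊛ w)) ⟩
  x ⊛ w ⊛ onePS       ≈⟨ rfl (x ⊛ w) ⟨⊛⟩ ≈-sym (U-W M) ⟩
  x ⊛ w ⊛ (uM ⊛ wM)   ≈⟨ solve 4 (λ x w u v → x :* w :* (u :* v) := x :* u :* w :* v) ≈-refl x w uM wM ⟩
  x ⊛ uM ⊛ w ⊛ wM     ≈⟨ binom-absorb M i i≤M ⟨⊛⟩ rfl w ⟨⊛⟩ rfl wM ⟩
  y ⊛ u ⊛ w ⊛ wM      ≈⟨ solve 4 (λ y u w v → y :* u :* w :* v := v :* y :* (u :* w)) ≈-refl y u w wM ⟩
  wM ⊛ y ⊛ (u ⊛ w)    ≈⟨ rfl (wM ⊛ y) ⟨⊛⟩ U-W i ⟩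
  wM ⊛ y ⊛ onePS      ≈⟨ ⊛-identityʳ (wM ⊛ y) ⟩
  wM ⊛ y              ∎
  where
  x  = binom M i
  y  = binom (suc M) (suc i)
  u  = U (suc i)
  w  = W (suc i)
  uM = U (suc M)
  wM = W (suc M)

T : ℕ → ℕ
T n = (n ℕ.* suc n) / 2

T-suc : ∀ n → T (suc n) ≡ T n ℕ.+ suc n
T-suc n = Eq.trans (cong (_/ 2) (expand n))
  (Eq.trans (+-distrib-/-∣ʳ (n ℕ.* suc n) (n∣m*n (suc n))) (cong (T n ℕ.+_) (m*n/n≡m (suc n) 2)))
  where
  open ℕ-Solver.+-*-Solver using () renaming (solve to ℕ-solve; _:=_ to _≔_; _:+_ to _⊞_; _:*_ to _⊠_; con to ℕ-con)
  expand : ∀ n → suc n ℕ.* suc (suc n) ≡ n ℕ.* suc n ℕ.+ suc n ℕ.* 2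
  expand = ℕ-solve 1 (λ n → (ℕ-con 1 ⊞ n) ⊠ (ℕ-con 2 ⊞ n) ≔ n ⊠ (ℕ-con 1 ⊞ n) ⊞ (ℕ-con 1 ⊞ n) ⊠ ℕ-con 2) refl

Q-T-suc : ∀ i → Q (T (suc i)) ≈ Q (T i) ⊛ Q (suc i)
Q-T-suc i = ≈-trans (Q-cong (T-suc i)) (Q-add (T i) (suc i))

Q-T-shift : ∀ i k → Q (T (suc i)) ⊛ Q (suc k) ≈ Q (T i) ⊛ Q (suc (suc (i ℕ.+ k)))
Q-T-shift i k = ≈-trans (≈-sym (Q-add (T (suc i)) (suc k))) (≈-trans (Q-cong exponents) (Q-add (T i) _))
  where
  exponents : T (suc i) ℕ.+ suc k ≡ T i ℕ.+ suc (suc (i ℕ.+ k))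
  exponents = Eq.trans (cong (ℕ._+ suc k) (T-suc i))
    (Eq.trans (ℕP.+-assoc (T i) (suc i) (suc k)) (cong (λ x → T i ℕ.+ suc x) (ℕP.+-suc i k)))

sgn-suc : ∀ n → cst (sgn (suc n)) ≈ neg (cst (sgn n))
sgn-suc n = pw (λ m → Eq.trans (ℤP.*-assoc -1ℤ (sgn n) (onePS m)) (ℤP.-1*i≡-i (sgn n ℤ.* onePS m)))

sgn-zero : cst (sgn 0) ≈ onePS
sgn-zero = pw (λ m → ℤP.*-identityˡ (onePS m))

gaussTerm : ℕ → ℕ → PS
gaussTerm M n = cst (sgn n) ⊛ Q (T n) ⊛ binom M n

gaussTerm-zero : ∀ M → gaussTerm M 0 ≈ onePS
gaussTerm-zero M = begin
  cst (sgn 0) ⊛ Q 0 ⊛ binom M 0 ≈⟨ sgn-zero ⟨⊛⟩ Q-zero ⟨⊛⟩ binom-zero M ⟩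
  onePS ⊛ onePS ⊛ onePS         ≈⟨ ≈-trans (⊛-identityˡ onePS ⟨⊛⟩ rfl onePS) (⊛-identityˡ onePS) ⟩
  onePS                         ∎

gaussTerm-pascal : ∀ M i → i ℕ.< M → gaussTerm (suc M) (suc i) ≈ gaussTerm M (suc i) ⊖ Q (suc M) ⊛ gaussTerm M i
gaussTerm-pascal M i i<M with split< i M i<M
... | k , refl = begin
  ε₁ ⊛ Q (T (suc i)) ⊛ binom (suc M) (suc i)
    ≈⟨ rfl (ε₁ ⊛ Q (T (suc i))) ⟨⊛⟩ binom-pascal₁ i k ⟩
  ε₁ ⊛ Q (T (suc i)) ⊛ (binom M (suc i) ⊕ Q (suc k) ⊛ binom M i)
    ≈⟨ solve 5 (λ s q b₁ q₂ b₀ → s :* q :* (b₁ :+ q₂ :* b₀) := s :* q :* b₁ :+ s :* (q :* q₂) :* b₀) ≈-refl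
         ε₁ (Q (T (suc i))) (binom M (suc i)) (Q (suc k)) (binom M i) ⟩
  gaussTerm M (suc i) ⊕ ε₁ ⊛ (Q (T (suc i)) ⊛ Q (suc k)) ⊛ binom M i
    ≈⟨ rfl (gaussTerm M (suc i)) ⟨⊕⟩ sgn-suc i ⟨⊛⟩ Q-T-shift i k ⟨⊛⟩ rfl (binom M i) ⟩
  gaussTerm M (suc i) ⊕ neg ε₀ ⊛ (Q (T i) ⊛ Q (suc M)) ⊛ binom M i
    ≈⟨ solve 5 (λ x s q qm b → x :+ (:- s) :* (q :* qm) :* b := x :- qm :* (s :* q :* b)) ≈-refl
         (gaussTerm M (suc i)) ε₀ (Q (T i)) (Q (suc M)) (binom M i) ⟩
  gaussTerm M (suc i) ⊖ Q (suc M) ⊛ gaussTerm M i ∎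
  where
  ε₁ = cst (sgn (suc i))
  ε₀ = cst (sgn i)

gaussTerm-top : ∀ M → gaussTerm (suc M) (suc M) ≈ neg (Q (suc M) ⊛ gaussTerm M M)
gaussTerm-top M = begin
  cst (sgn (suc M)) ⊛ Q (T (suc M)) ⊛ binom (suc M) (suc M)
    ≈⟨ sgn-suc M ⟨⊛⟩ Q-T-suc M ⟨⊛⟩ ≈-trans (binom-diag (suc M)) (≈-sym (binom-diag M)) ⟩
  neg (cst (sgn M)) ⊛ (Q (T M) ⊛ Q (suc M)) ⊛ binom M M
    ≈⟨ solve 4 (λ s q qm b → (:- s) :* (q :* qm) :* b := :- (qm :* (s :* q :* b))) ≈-refl
         (cst (sgn M)) (Q (T M)) (Q (suc M)) (binom M M) ⟩
  neg (Q (suc M) ⊛ gaussTerm M M) ∎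

gauss-identity : ∀ M → Σ₀ M (gaussTerm M) ≈ P M
gauss-identity zero    = pw (λ m → Eq.trans (ℤP.+-identityʳ _) (at (gaussTerm-zero 0) m))
gauss-identity (suc M) = begin
  gaussTerm (suc M) 0 ⊕ (ΣPS M (gaussTerm (suc M)) ⊕ gaussTerm (suc M) (suc M))
    ≈⟨ ≈-trans (gaussTerm-zero (suc M)) (≈-sym (gaussTerm-zero M)) ⟨⊕⟩ (inner ⟨⊕⟩ gaussTerm-top M) ⟩
  gaussTerm M 0 ⊕ ((ΣPS M (gaussTerm M) ⊖ q ⊛ X) ⊕ neg (q ⊛ gaussTerm M M))
    ≈⟨ solve 5 (λ a s q x t → a :+ ((s :- q :* x) :+ (:- (q :* t))) := (a :+ s) :- q :* (x :+ t)) ≈-refl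
         (gaussTerm M 0) (ΣPS M (gaussTerm M)) q X (gaussTerm M M) ⟩
  Σ₀ M (gaussTerm M) ⊖ q ⊛ (X ⊕ gaussTerm M M)
    ≈⟨ gauss-identity M ⟨⊖⟩ rfl q ⟨⊛⟩ ≈-trans (Σ₀-shift M (gaussTerm M)) (gauss-identity M) ⟩
  P M ⊖ q ⊛ P M                 ≈⟨ solve 2 (λ p q → p :- q :* p := p :* (con 1ℤ :- q)) ≈-refl (P M) q ⟩
  P M ⊛ (cst 1ℤ ⊖ q)            ≈⟨ rfl (P M) ⟨⊛⟩ ≈-sym (U≈cst (suc M)) ⟩
  P (suc M)                     ∎
  where
  q = Q (suc M)
  X = ΣPS M (λ n → gaussTerm M (n ℕ.∸ 1))
  inner : ΣPS M (gaussTerm (suc M)) ≈ ΣPS M (gaussTerm M) ⊖ q ⊛ X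
  inner = ≈-trans (ΣPS-cong M (gaussTerm (suc M)) (λ n → gaussTerm M n ⊖ q ⊛ gaussTerm M (n ℕ.∸ 1)) (gaussTerm-pascal M))
          (≈-trans (ΣPS-⊖ M (gaussTerm M) (λ n → q ⊛ gaussTerm M (n ℕ.∸ 1)))
                   (rfl (ΣPS M (gaussTerm M)) ⟨⊖⟩ ≈-sym (ΣPS-⊛ˡ M q (λ n → gaussTerm M (n ℕ.∸ 1)))))

-- By the second q-Pascal recurrence each term splits into a telescoping difference of
-- the weighted terms n·gaussTerm M n plus gaussTerm M (n-1), so the sum reduces to the
-- Gauss identity.

derivTerm : ℕ → ℕ → PS
derivTerm N n = cst (sgn (n ℕ.∸ 1)) ⊛ cst (+ n) ⊛ Q (T (n ℕ.∸ 1)) ⊛ binom N n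

module _ (M : ℕ) where
  private
    weighted : ℕ → PS
    weighted n = cst (sgn n) ⊛ cst (+ n) ⊛ Q (T n) ⊛ binom M n

    weighted-zero : weighted 0 ≈ zeroPS
    weighted-zero = solve 3 (λ s q b → s :* con 0ℤ :* q :* b := con 0ℤ) ≈-refl (cst (sgn 0)) (Q (T 0)) (binom M 0)

    derivTerm-pascal : ∀ i → i ℕ.< M → derivTerm (suc M) (suc i) ≈ (weighted i ⊖ weighted (suc i)) ⊕ gaussTerm M i
    derivTerm-pascal i i<M with split< i M i<M
    ... | k , refl = begin
      ε ⊛ cst (+ suc i) ⊛ Q (T i) ⊛ binom (suc M) (suc i)
        ≈⟨ rfl ε ⟨⊛⟩ cst-suc i ⟨⊛⟩ rfl (Q (T i)) ⟨⊛⟩ binom-pascal₂ i k ⟩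
      ε ⊛ (cst 1ℤ ⊕ ν) ⊛ Q (T i) ⊛ (Q (suc i) ⊛ binom M (suc i) ⊕ binom M i)
        ≈⟨ solve 6 (λ s n q qi b₁ b₀ → s :* (con 1ℤ :+ n) :* q :* (qi :* b₁ :+ b₀)
              := ((s :* n :* q :* b₀) :- (:- s) :* (con 1ℤ :+ n) :* (q :* qi) :* b₁) :+ s :* q :* b₀) ≈-refl
             ε ν (Q (T i)) (Q (suc i)) (binom M (suc i)) (binom M i) ⟩
      (weighted i ⊖ neg ε ⊛ (cst 1ℤ ⊕ ν) ⊛ (Q (T i) ⊛ Q (suc i)) ⊛ binom M (suc i)) ⊕ gaussTerm M i
        ≈⟨ rfl (weighted i) ⟨⊖⟩ (≈-sym (sgn-suc i) ⟨⊛⟩ ≈-sym (cst-suc i) ⟨⊛⟩ ≈-sym (Q-T-suc i) ⟨⊛⟩ rfl (binom M (suc i)))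
           ⟨⊕⟩ rfl (gaussTerm M i) ⟩
      (weighted i ⊖ weighted (suc i)) ⊕ gaussTerm M i ∎
      where
      ε = cst (sgn i)
      ν = cst (+ i)

    derivTerm-top : derivTerm (suc M) (suc M) ≈ weighted M ⊕ gaussTerm M M
    derivTerm-top = begin
      ε ⊛ cst (+ suc M) ⊛ Q (T M) ⊛ binom (suc M) (suc M)
        ≈⟨ rfl ε ⟨⊛⟩ cst-suc M ⟨⊛⟩ rfl (Q (T M)) ⟨⊛⟩ ≈-trans (binom-diag (suc M)) (≈-sym (binom-diag M)) ⟩
      ε ⊛ (cst 1ℤ ⊕ cst (+ M)) ⊛ Q (T M) ⊛ binom M M
        ≈⟨ solve 4 (λ s n q b → s :* (con 1ℤ :+ n) :* q :* b := s :* n :* q :* b :+ s :* q :* b) ≈-refl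
             ε (cst (+ M)) (Q (T M)) (binom M M) ⟩
      weighted M ⊕ gaussTerm M M ∎
      where ε = cst (sgn M)

  gauss-derivative : ΣPS (suc M) (derivTerm (suc M)) ≈ P M
  gauss-derivative = begin
    ΣPS M (derivTerm (suc M)) ⊕ derivTerm (suc M) (suc M)
      ≈⟨ ΣPS-cong M (derivTerm (suc M)) (λ n → (weighted (n ℕ.∸ 1) ⊖ weighted n) ⊕ gaussTerm M (n ℕ.∸ 1)) derivTerm-pascal
         ⟨⊕⟩ derivTerm-top ⟩
    ΣPS M (λ n → (weighted (n ℕ.∸ 1) ⊖ weighted n) ⊕ gaussTerm M (n ℕ.∸ 1)) ⊕ (weighted M ⊕ gaussTerm M M)
      ≈⟨ ΣPS-⊕ M (λ n → weighted (n ℕ.∸ 1) ⊖ weighted n) (λ n → gaussTerm M (n ℕ.∸ 1)) ⟨⊕⟩ rfl (weighted M ⊕ gaussTerm M M) ⟩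
    (ΣPS M (λ n → weighted (n ℕ.∸ 1) ⊖ weighted n) ⊕ X) ⊕ (weighted M ⊕ gaussTerm M M)
      ≈⟨ ΣPS-telescope M weighted ⟨⊕⟩ rfl X ⟨⊕⟩ rfl (weighted M ⊕ gaussTerm M M) ⟩
    ((weighted 0 ⊖ weighted M) ⊕ X) ⊕ (weighted M ⊕ gaussTerm M M)
      ≈⟨ solve 4 (λ a c x t → ((a :- c) :+ x) :+ (c :+ t) := a :+ (x :+ t)) ≈-refl (weighted 0) (weighted M) X (gaussTerm M M) ⟩
    weighted 0 ⊕ (X ⊕ gaussTerm M M) ≈⟨ weighted-zero ⟨⊕⟩ Σ₀-shift M (gaussTerm M) ⟩
    zeroPS ⊕ Σ₀ M (gaussTerm M)      ≈⟨ pw (λ m → ℤP.+-identityˡ (Σ₀ M (gaussTerm M) m)) ⟩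
    Σ₀ M (gaussTerm M)               ≈⟨ gauss-identity M ⟩
    P M                              ∎
    where X = ΣPS M (λ n → gaussTerm M (n ℕ.∸ 1))

-- Passing from N to N+1, the first q-Pascal recurrence and
-- absorption turn the new terms into q^{N+1}/(1-q^{N+1}) times the differentiated Gauss sum.

σ : ℕ → PS
σ j = Q j ⊛ W j ⊛ W j

termA : ℕ → ℕ → PS
termA N n = binom N n ⊛ (cst (sgn (n ℕ.∸ 1)) ⊛ cst (+ n) ⊛ Q (T n)) ⊛ W n

termA-pascal : ∀ M i → i ℕ.< M → termA (suc M) (suc i) ≈ termA M (suc i) ⊕ Q (suc M) ⊛ W (suc M) ⊛ derivTerm (suc M) (suc i)
termA-pascal M i i<M with split< i M i<M
... | k , refl = begin
  binom (suc M) n ⊛ c ⊛ W n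
    ≈⟨ binom-pascal₁ i k ⟨⊛⟩ rfl c ⟨⊛⟩ rfl (W n) ⟩
  (binom M n ⊕ Q (suc k) ⊛ binom M i) ⊛ c ⊛ W n
    ≈⟨ solve 5 (λ b₁ qk b₀ c w → (b₁ :+ qk :* b₀) :* c :* w := b₁ :* c :* w :+ qk :* c :* (b₀ :* w)) ≈-refl
         (binom M n) (Q (suc k)) (binom M i) c (W n) ⟩
  termA M n ⊕ Q (suc k) ⊛ c ⊛ (binom M i ⊛ W n)
    ≈⟨ rfl (termA M n) ⟨⊕⟩ rfl (Q (suc k)) ⟨⊛⟩ (rfl (ε ⊛ ν) ⟨⊛⟩ Q-T-suc i) ⟨⊛⟩ binom-absorb-W M i (ℕP.<⇒≤ i<M) ⟩
  termA M n ⊕ Q (suc k) ⊛ (ε ⊛ ν ⊛ (Q (T i) ⊛ Q n)) ⊛ (W (suc M) ⊛ binom (suc M) n)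
    ≈⟨ rfl (termA M n) ⟨⊕⟩ solve 7 (λ qk s v qt qn w y → qk :* (s :* v :* (qt :* qn)) :* (w :* y) := (qk :* qn) :* w :* (s :* v :* qt :* y)) ≈-refl
         (Q (suc k)) ε ν (Q (T i)) (Q n) (W (suc M)) (binom (suc M) n) ⟩
  termA M n ⊕ (Q (suc k) ⊛ Q n) ⊛ W (suc M) ⊛ derivTerm (suc M) n
    ≈⟨ rfl (termA M n) ⟨⊕⟩ ≈-trans (≈-sym (Q-add (suc k) n)) (Q-cong (Eq.sym (2+i+k≡1+k+1+i i k))) ⟨⊛⟩ rfl (W (suc M)) ⟨⊛⟩ rfl (derivTerm (suc M) n) ⟩
  termA M n ⊕ Q (suc M) ⊛ W (suc M) ⊛ derivTerm (suc M) n ∎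
  where
  n = suc i
  ε = cst (sgn i)
  ν = cst (+ n)
  c = ε ⊛ ν ⊛ Q (T n)

termA-top : ∀ M → termA (suc M) (suc M) ≈ Q (suc M) ⊛ W (suc M) ⊛ derivTerm (suc M) (suc M)
termA-top M = begin
  binom (suc M) (suc M) ⊛ (ε ⊛ ν ⊛ Q (T (suc M))) ⊛ W (suc M)
    ≈⟨ rfl (binom (suc M) (suc M)) ⟨⊛⟩ (rfl (ε ⊛ ν) ⟨⊛⟩ Q-T-suc M) ⟨⊛⟩ rfl (W (suc M)) ⟩
  binom (suc M) (suc M) ⊛ (ε ⊛ ν ⊛ (Q (T M) ⊛ Q (suc M))) ⊛ W (suc M)
    ≈⟨ solve 6 (λ y s v qt q w → y :* (s :* v :* (qt :* q)) :* w := q :* w :* (s :* v :* qt :* y)) ≈-refl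
         (binom (suc M) (suc M)) ε ν (Q (T M)) (Q (suc M)) (W (suc M)) ⟩
  Q (suc M) ⊛ W (suc M) ⊛ derivTerm (suc M) (suc M) ∎
  where
  ε = cst (sgn M)
  ν = cst (+ suc M)

σ-step : ∀ M → Q (suc M) ⊛ W (suc M) ⊛ P M ≈ σ (suc M) ⊛ P (suc M)
σ-step M = begin
  qw ⊛ P M                                ≈⟨ ≈-sym (⊛-identityʳ (qw ⊛ P M)) ⟩
  qw ⊛ P M ⊛ onePS                        ≈⟨ rfl (qw ⊛ P M) ⟨⊛⟩ ≈-sym (W-U M) ⟩
  qw ⊛ P M ⊛ (W (suc M) ⊛ U (suc M))
    ≈⟨ solve 5 (λ q w p w₂ u → q :* w :* p :* (w₂ :* u) := q :* w :* w₂ :* (p :* u)) ≈-refl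
         (Q (suc M)) (W (suc M)) (P M) (W (suc M)) (U (suc M)) ⟩
  σ (suc M) ⊛ P (suc M)                   ∎
  where qw = Q (suc M) ⊛ W (suc M)

identityA : ∀ N → ΣPS N (termA N) ≈ ΣPS N (λ j → σ j ⊛ P j)
identityA zero    = ≈-refl
identityA (suc M) = begin
  ΣPS M (termA (suc M)) ⊕ termA (suc M) (suc M)
    ≈⟨ ΣPS-cong M (termA (suc M)) (λ n → termA M n ⊕ qw ⊛ derivTerm (suc M) n) (termA-pascal M) ⟨⊕⟩ termA-top M ⟩
  ΣPS M (λ n → termA M n ⊕ qw ⊛ derivTerm (suc M) n) ⊕ qw ⊛ derivTerm (suc M) (suc M)
    ≈⟨ ≈-trans (ΣPS-⊕ M (termA M) (λ n → qw ⊛ derivTerm (suc M) n)) (rfl (ΣPS M (termA M)) ⟨⊕⟩ ≈-sym (ΣPS-⊛ˡ M qw (derivTerm (suc M))))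
       ⟨⊕⟩ rfl (qw ⊛ derivTerm (suc M) (suc M)) ⟩
  (ΣPS M (termA M) ⊕ qw ⊛ ΣPS M (derivTerm (suc M))) ⊕ qw ⊛ derivTerm (suc M) (suc M)
    ≈⟨ solve 4 (λ a q g t → (a :+ q :* g) :+ q :* t := a :+ q :* (g :+ t)) ≈-refl
         (ΣPS M (termA M)) qw (ΣPS M (derivTerm (suc M))) (derivTerm (suc M) (suc M)) ⟩
  ΣPS M (termA M) ⊕ qw ⊛ ΣPS (suc M) (derivTerm (suc M))
    ≈⟨ identityA M ⟨⊕⟩ rfl qw ⟨⊛⟩ gauss-derivative M ⟩
  ΣPS M (λ j → σ j ⊛ P j) ⊕ qw ⊛ P M ≈⟨ rfl (ΣPS M (λ j → σ j ⊛ P j)) ⟨⊕⟩ σ-step M ⟩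
  ΣPS (suc M) (λ j → σ j ⊛ P j) ∎
  where qw = Q (suc M) ⊛ W (suc M)

-- The Durfee identity  Σ_{n=0}^{N} (q)_N [N n] q^{n²}/(q)_n = 1.
-- For 0 < n ≤ M the terms satisfy
--   durfeeTerm (M+1) n = durfeeTerm M n + teleTerm M n - teleTerm M (n+1),
-- so passing from M to M+1 adds a telescoping sum, which vanishes.

durfeeTerm : ℕ → ℕ → PS
durfeeTerm N n = P N ⊛ (binom N n ⊛ Q (n ℕ.* n) ⊛ J n)

teleTerm : ℕ → ℕ → PS
teleTerm M zero    = zeroPS
teleTerm M (suc i) = Q (M ℕ.∸ i) ⊛ P M ⊛ binom M i ⊛ Q (suc i ℕ.* suc i) ⊛ J i

-- The recurrence for n = i+1 and M = 1+i+k, after multiplying by C = (q)_n (q)_{k+1}: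
-- with x = q^n and y = q^{k+1} all four terms become base times a polynomial in x, y.
module _ (i k : ℕ) where
  private
    n    = suc i
    M    = suc (i ℕ.+ k)
    x    = Q n
    y    = Q (suc k)
    C    = P n ⊛ P (suc k)
    base = P M ⊛ P M ⊛ Q (n ℕ.* n) ⊛ J n

    durfee-next : durfeeTerm (suc M) n ⊛ C ≈ base ⊛ U (suc M) ⊛ U (suc M)
    durfee-next = begin
      P M ⊛ U (suc M) ⊛ (binom (suc M) n ⊛ Q (n ℕ.* n) ⊛ J n) ⊛ C
        ≈⟨ solve 6 (λ p u b q j c → p :* u :* (b :* q :* j) :* c := p :* u :* q :* j :* (b :* c)) ≈-refl
             (P M) (U (suc M)) (binom (suc M) n) (Q (n ℕ.* n)) (J n) C ⟩
      P M ⊛ U (suc M) ⊛ Q (n ℕ.* n) ⊛ J n ⊛ (binom (suc M) n ⊛ C)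
        ≈⟨ rfl (P M ⊛ U (suc M) ⊛ Q (n ℕ.* n) ⊛ J n) ⟨⊛⟩ binom-P (suc M) n (suc k) (1+i+k∸i i k) ⟩
      P M ⊛ U (suc M) ⊛ Q (n ℕ.* n) ⊛ J n ⊛ (P M ⊛ U (suc M))
        ≈⟨ solve 5 (λ p u q j u′ → p :* u :* q :* j :* (p :* u′) := p :* p :* q :* j :* u :* u′) ≈-refl
             (P M) (U (suc M)) (Q (n ℕ.* n)) (J n) (U (suc M)) ⟩
      base ⊛ U (suc M) ⊛ U (suc M) ∎

    durfee-same : durfeeTerm M n ⊛ C ≈ base ⊛ U (suc k)
    durfee-same = begin
      P M ⊛ (binom M n ⊛ Q (n ℕ.* n) ⊛ J n) ⊛ (P n ⊛ (P k ⊛ U (suc k)))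
        ≈⟨ solve 7 (λ p b q j pn pk u → p :* (b :* q :* j) :* (pn :* (pk :* u)) := p :* q :* j :* u :* (b :* (pn :* pk))) ≈-refl
             (P M) (binom M n) (Q (n ℕ.* n)) (J n) (P n) (P k) (U (suc k)) ⟩
      P M ⊛ Q (n ℕ.* n) ⊛ J n ⊛ U (suc k) ⊛ (binom M n ⊛ (P n ⊛ P k))
        ≈⟨ rfl (P M ⊛ Q (n ℕ.* n) ⊛ J n ⊛ U (suc k)) ⟨⊛⟩ binom-P M n k (ℕP.m+n∸m≡n i k) ⟩
      P M ⊛ Q (n ℕ.* n) ⊛ J n ⊛ U (suc k) ⊛ P M
        ≈⟨ solve 5 (λ p q j u p′ → p :* q :* j :* u :* p′ := p :* p′ :* q :* j :* u) ≈-refl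
             (P M) (Q (n ℕ.* n)) (J n) (U (suc k)) (P M) ⟩
      base ⊛ U (suc k) ∎

    tele-low : teleTerm M n ⊛ C ≈ base ⊛ y ⊛ U n ⊛ U n
    tele-low = begin
      Q (M ℕ.∸ i) ⊛ P M ⊛ binom M i ⊛ Q (n ℕ.* n) ⊛ J i ⊛ (P i ⊛ U n ⊛ P (suc k))
        ≈⟨ solve 8 (λ qy p b q j pi u pk → qy :* p :* b :* q :* j :* (pi :* u :* pk) := qy :* p :* q :* j :* u :* (b :* (pi :* pk))) ≈-refl
             (Q (M ℕ.∸ i)) (P M) (binom M i) (Q (n ℕ.* n)) (J i) (P i) (U n) (P (suc k)) ⟩
      Q (M ℕ.∸ i) ⊛ P M ⊛ Q (n ℕ.* n) ⊛ J i ⊛ U n ⊛ (binom M i ⊛ (P i ⊛ P (suc k)))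
        ≈⟨ Q-cong (1+i+k∸i i k) ⟨⊛⟩ rfl (P M) ⟨⊛⟩ rfl (Q (n ℕ.* n)) ⟨⊛⟩ ≈-sym (J-U i) ⟨⊛⟩ rfl (U n)
           ⟨⊛⟩ binom-P M i (suc k) (1+i+k∸i i k) ⟩
      y ⊛ P M ⊛ Q (n ℕ.* n) ⊛ (J n ⊛ U n) ⊛ U n ⊛ P M
        ≈⟨ solve 6 (λ y p q j u p′ → y :* p :* q :* (j :* u) :* u :* p′ := p :* p′ :* q :* j :* y :* u :* u) ≈-refl
             y (P M) (Q (n ℕ.* n)) (J n) (U n) (P M) ⟩
      base ⊛ y ⊛ U n ⊛ U n ∎

    exponent : k ℕ.+ suc n ℕ.* suc n ≡ n ℕ.* n ℕ.+ n ℕ.+ n ℕ.+ suc k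
    exponent = ℕS.solve 2 (λ i k → k ℕS.:+ (ℕS.con 2 ℕS.:+ i) ℕS.:* (ℕS.con 2 ℕS.:+ i)
                 ℕS.:= (ℕS.con 1 ℕS.:+ i) ℕS.:* (ℕS.con 1 ℕS.:+ i) ℕS.:+ (ℕS.con 1 ℕS.:+ i)
                       ℕS.:+ (ℕS.con 1 ℕS.:+ i) ℕS.:+ (ℕS.con 1 ℕS.:+ k)) refl i k
      where module ℕS = ℕ-Solver.+-*-Solver

    tele-high : teleTerm M (suc n) ⊛ C ≈ base ⊛ x ⊛ x ⊛ y ⊛ U (suc k)
    tele-high = begin
      Q (M ℕ.∸ n) ⊛ P M ⊛ binom M n ⊛ Q (suc n ℕ.* suc n) ⊛ J n ⊛ (P n ⊛ (P k ⊛ U (suc k)))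
        ≈⟨ solve 8 (λ qk p b q j pn pk u → qk :* p :* b :* q :* j :* (pn :* (pk :* u)) := (qk :* q) :* p :* j :* u :* (b :* (pn :* pk))) ≈-refl
             (Q (M ℕ.∸ n)) (P M) (binom M n) (Q (suc n ℕ.* suc n)) (J n) (P n) (P k) (U (suc k)) ⟩
      (Q (M ℕ.∸ n) ⊛ Q (suc n ℕ.* suc n)) ⊛ P M ⊛ J n ⊛ U (suc k) ⊛ (binom M n ⊛ (P n ⊛ P k))
        ≈⟨ powers ⟨⊛⟩ rfl (P M) ⟨⊛⟩ rfl (J n) ⟨⊛⟩ rfl (U (suc k)) ⟨⊛⟩ binom-P M n k (ℕP.m+n∸m≡n i k) ⟩
      Q (n ℕ.* n) ⊛ x ⊛ x ⊛ y ⊛ P M ⊛ J n ⊛ U (suc k) ⊛ P M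
        ≈⟨ solve 8 (λ q x x′ y p j u p′ → q :* x :* x′ :* y :* p :* j :* u :* p′ := p :* p′ :* q :* j :* x :* x′ :* y :* u) ≈-refl
             (Q (n ℕ.* n)) x x y (P M) (J n) (U (suc k)) (P M) ⟩
      base ⊛ x ⊛ x ⊛ y ⊛ U (suc k) ∎
      where
      powers : Q (M ℕ.∸ n) ⊛ Q (suc n ℕ.* suc n) ≈ Q (n ℕ.* n) ⊛ x ⊛ x ⊛ y
      powers = ≈-trans (≈-sym (Q-add (M ℕ.∸ n) (suc n ℕ.* suc n)))
        (≈-trans (Q-cong (Eq.trans (cong (ℕ._+ suc n ℕ.* suc n) (ℕP.m+n∸m≡n i k)) exponent))
        (≈-trans (Q-add (n ℕ.* n ℕ.+ n ℕ.+ n) (suc k))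
                 (≈-trans (Q-add (n ℕ.* n ℕ.+ n) n) (Q-add (n ℕ.* n) n ⟨⊛⟩ rfl x) ⟨⊛⟩ rfl y)))

    square-split : U (suc M) ⊛ U (suc M) ≈ U (suc k) ⊕ (y ⊛ U n ⊛ U n ⊖ x ⊛ x ⊛ y ⊛ U (suc k))
    square-split = begin
      U (suc M) ⊛ U (suc M)
        ≈⟨ U-xy ⟨⊛⟩ U-xy ⟩
      (cst 1ℤ ⊖ x ⊛ y) ⊛ (cst 1ℤ ⊖ x ⊛ y)
        ≈⟨ solve 2 (λ x y → (con 1ℤ :- x :* y) :* (con 1ℤ :- x :* y)
                 := (con 1ℤ :- y) :+ (y :* (con 1ℤ :- x) :* (con 1ℤ :- x) :- x :* x :* y :* (con 1ℤ :- y))) ≈-refl x y ⟩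
      (cst 1ℤ ⊖ y) ⊕ (y ⊛ (cst 1ℤ ⊖ x) ⊛ (cst 1ℤ ⊖ x) ⊖ x ⊛ x ⊛ y ⊛ (cst 1ℤ ⊖ y))
        ≈⟨ ≈-sym (U≈cst (suc k) ⟨⊕⟩ (rfl y ⟨⊛⟩ U≈cst n ⟨⊛⟩ U≈cst n ⟨⊖⟩ rfl (x ⊛ x ⊛ y) ⟨⊛⟩ U≈cst (suc k))) ⟩
      U (suc k) ⊕ (y ⊛ U n ⊛ U n ⊖ x ⊛ x ⊛ y ⊛ U (suc k)) ∎
      where
      U-xy : U (suc M) ≈ cst 1ℤ ⊖ x ⊛ y
      U-xy = ≈-trans (U≈cst (suc M))
        (rfl (cst 1ℤ) ⟨⊖⟩ ≈-trans (Q-cong (Eq.trans (2+i+k≡1+k+1+i i k) (ℕP.+-comm (suc k) (suc i)))) (Q-add n (suc k)))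

  durfeeTerm-step : durfeeTerm (suc M) n ≈ durfeeTerm M n ⊕ (teleTerm M n ⊖ teleTerm M (suc n))
  durfeeTerm-step = ⊛-cancelʳ C _ _ (P⊛P-const n (suc k)) (begin
    durfeeTerm (suc M) n ⊛ C                              ≈⟨ durfee-next ⟩
    base ⊛ U (suc M) ⊛ U (suc M)                          ≈⟨ *-assoc base (U (suc M)) (U (suc M)) ⟩
    base ⊛ (U (suc M) ⊛ U (suc M))                        ≈⟨ rfl base ⟨⊛⟩ square-split ⟩
    base ⊛ (U (suc k) ⊕ (y ⊛ U n ⊛ U n ⊖ x ⊛ x ⊛ y ⊛ U (suc k)))
      ≈⟨ solve 5 (λ b u y v x → b :* (u :+ (y :* v :* v :- x :* x :* y :* u)) := b :* u :+ (b :* y :* v :* v :- b :* x :* x :* y :* u)) ≈-refl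
           base (U (suc k)) y (U n) x ⟩
    base ⊛ U (suc k) ⊕ (base ⊛ y ⊛ U n ⊛ U n ⊖ base ⊛ x ⊛ x ⊛ y ⊛ U (suc k))
      ≈⟨ ≈-sym (durfee-same ⟨⊕⟩ (tele-low ⟨⊖⟩ tele-high)) ⟩
    durfeeTerm M n ⊛ C ⊕ (teleTerm M n ⊛ C ⊖ teleTerm M (suc n) ⊛ C)
      ≈⟨ solve 4 (λ d e f c → d :* c :+ (e :* c :- f :* c) := (d :+ (e :- f)) :* c) ≈-refl
           (durfeeTerm M n) (teleTerm M n) (teleTerm M (suc n)) C ⟩
    (durfeeTerm M n ⊕ (teleTerm M n ⊖ teleTerm M (suc n))) ⊛ C ∎)

durfeeTerm-pascal : ∀ M i → i ℕ.< M →
  durfeeTerm (suc M) (suc i) ≈ durfeeTerm M (suc i) ⊕ (teleTerm M (suc i) ⊖ teleTerm M (suc (suc i)))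
durfeeTerm-pascal M i i<M with split< i M i<M
... | k , refl = durfeeTerm-step i k

durfeeTerm-zero : ∀ N → durfeeTerm N 0 ≈ P N
durfeeTerm-zero N = begin
  P N ⊛ (binom N 0 ⊛ Q 0 ⊛ J 0) ≈⟨ rfl (P N) ⟨⊛⟩ (binom-zero N ⟨⊛⟩ Q-zero ⟨⊛⟩ J-zero) ⟩
  P N ⊛ (onePS ⊛ onePS ⊛ onePS) ≈⟨ rfl (P N) ⟨⊛⟩ ≈-trans (⊛-identityˡ onePS ⟨⊛⟩ rfl onePS) (⊛-identityˡ onePS) ⟩
  P N ⊛ onePS                   ≈⟨ ⊛-identityʳ (P N) ⟩
  P N                           ∎

durfeeTerm-bottom : ∀ M → durfeeTerm (suc M) 0 ≈ durfeeTerm M 0 ⊕ (teleTerm M 0 ⊖ teleTerm M 1)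
durfeeTerm-bottom M = begin
  durfeeTerm (suc M) 0 ≈⟨ durfeeTerm-zero (suc M) ⟩
  P M ⊛ U (suc M)      ≈⟨ rfl (P M) ⟨⊛⟩ ≈-trans (U≈cst (suc M)) (rfl (cst 1ℤ) ⟨⊖⟩ ≈-trans (Q-cong (ℕP.+-comm 1 M)) (Q-add M 1)) ⟩
  P M ⊛ (cst 1ℤ ⊖ Q M ⊛ Q 1)
    ≈⟨ solve 3 (λ p q q₁ → p :* (con 1ℤ :- q :* q₁) := p :+ (con 0ℤ :- q :* p :* con 1ℤ :* q₁ :* con 1ℤ)) ≈-refl (P M) (Q M) (Q 1) ⟩
  P M ⊕ (zeroPS ⊖ Q M ⊛ P M ⊛ cst 1ℤ ⊛ Q 1 ⊛ cst 1ℤ)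
    ≈⟨ ≈-sym (durfeeTerm-zero M ⟨⊕⟩ (rfl zeroPS ⟨⊖⟩ rfl (Q M ⊛ P M) ⟨⊛⟩ ≈-trans (binom-zero M) onePS≈cst ⟨⊛⟩ rfl (Q 1)
              ⟨⊛⟩ ≈-trans J-zero onePS≈cst)) ⟩
  durfeeTerm M 0 ⊕ (teleTerm M 0 ⊖ teleTerm M 1) ∎

durfeeTerm-top : ∀ M → durfeeTerm (suc M) (suc M) ≈ teleTerm M (suc M)
durfeeTerm-top M = begin
  P M ⊛ U (suc M) ⊛ (binom (suc M) (suc M) ⊛ q ⊛ J (suc M))
    ≈⟨ rfl (P M ⊛ U (suc M)) ⟨⊛⟩ (≈-trans (binom-diag (suc M)) (≈-sym (binom-diag M)) ⟨⊛⟩ rfl q ⟨⊛⟩ J-suc M) ⟩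
  P M ⊛ U (suc M) ⊛ (binom M M ⊛ q ⊛ (J M ⊛ W (suc M)))
    ≈⟨ solve 6 (λ p u c q j w → p :* u :* (c :* q :* (j :* w)) := p :* c :* q :* j :* (u :* w)) ≈-refl
         (P M) (U (suc M)) (binom M M) q (J M) (W (suc M)) ⟩
  P M ⊛ binom M M ⊛ q ⊛ J M ⊛ (U (suc M) ⊛ W (suc M))
    ≈⟨ rfl (P M ⊛ binom M M ⊛ q ⊛ J M) ⟨⊛⟩ U-W M ⟩
  P M ⊛ binom M M ⊛ q ⊛ J M ⊛ onePS
    ≈⟨ ≈-trans (⊛-identityʳ (P M ⊛ binom M M ⊛ q ⊛ J M)) (≈-sym (⊛-identityˡ (P M ⊛ binom M M ⊛ q ⊛ J M))) ⟩
  onePS ⊛ (P M ⊛ binom M M ⊛ q ⊛ J M)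
    ≈⟨ ≈-sym (≈-trans (Q-cong (ℕP.n∸n≡0 M)) Q-zero) ⟨⊛⟩ rfl (P M ⊛ binom M M ⊛ q ⊛ J M) ⟩
  Q (M ℕ.∸ M) ⊛ (P M ⊛ binom M M ⊛ q ⊛ J M)
    ≈⟨ solve 5 (λ e p b q j → e :* (p :* b :* q :* j) := e :* p :* b :* q :* j) ≈-refl (Q (M ℕ.∸ M)) (P M) (binom M M) q (J M) ⟩
  teleTerm M (suc M) ∎
  where q = Q (suc M ℕ.* suc M)

durfee-identity : ∀ N → Σ₀ N (durfeeTerm N) ≈ onePS
durfee-identity zero    = ≈-trans (pw (λ m → ℤP.+-identityʳ (durfeeTerm 0 0 m))) (durfeeTerm-zero 0)
durfee-identity (suc M) = begin
  durfeeTerm (suc M) 0 ⊕ (ΣPS M (durfeeTerm (suc M)) ⊕ durfeeTerm (suc M) (suc M))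
    ≈⟨ durfeeTerm-bottom M ⟨⊕⟩ (ΣPS-cong M (durfeeTerm (suc M)) (λ n → durfeeTerm M n ⊕ (E n ⊖ E (suc n))) (durfeeTerm-pascal M)
                                ⟨⊕⟩ durfeeTerm-top M) ⟩
  (durfeeTerm M 0 ⊕ (E 0 ⊖ E 1)) ⊕ (ΣPS M (λ n → durfeeTerm M n ⊕ (E n ⊖ E (suc n))) ⊕ E (suc M))
    ≈⟨ rfl (durfeeTerm M 0 ⊕ (E 0 ⊖ E 1)) ⟨⊕⟩ (≈-trans (ΣPS-⊕ M (durfeeTerm M) (λ n → E n ⊖ E (suc n)))
                                                       (rfl (ΣPS M (durfeeTerm M)) ⟨⊕⟩ telescope)
                                             ⟨⊕⟩ rfl (E (suc M))) ⟩
  (durfeeTerm M 0 ⊕ (E 0 ⊖ E 1)) ⊕ ((ΣPS M (durfeeTerm M) ⊕ (E 1 ⊖ E (suc M))) ⊕ E (suc M))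
    ≈⟨ solve 5 (λ a e₀ e₁ s eM → (a :+ (e₀ :- e₁)) :+ ((s :+ (e₁ :- eM)) :+ eM) := (a :+ s) :+ e₀) ≈-refl
         (durfeeTerm M 0) (E 0) (E 1) (ΣPS M (durfeeTerm M)) (E (suc M)) ⟩
  Σ₀ M (durfeeTerm M) ⊕ zeroPS ≈⟨ pw (λ m → ℤP.+-identityʳ (Σ₀ M (durfeeTerm M) m)) ⟩
  Σ₀ M (durfeeTerm M)          ≈⟨ durfee-identity M ⟩
  onePS                        ∎
  where
  E = teleTerm M
  telescope : ΣPS M (λ n → E n ⊖ E (suc n)) ≈ E 1 ⊖ E (suc M)
  telescope = ≈-trans (ΣPS-cong M (λ n → E n ⊖ E (suc n)) (λ n → E (suc (n ℕ.∸ 1)) ⊖ E (suc n)) (λ _ _ → ≈-refl))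
                      (ΣPS-telescope M (E ∘ suc))

durfee-sum : ∀ N → ΣPS N (durfeeTerm N) ≈ onePS ⊖ P N
durfee-sum N = begin
  ΣPS N (durfeeTerm N)                    ≈⟨ solve 2 (λ x p → x := (p :+ x) :- p) ≈-refl (ΣPS N (durfeeTerm N)) (durfeeTerm N 0) ⟩
  Σ₀ N (durfeeTerm N) ⊖ durfeeTerm N 0    ≈⟨ durfee-identity N ⟨⊖⟩ durfeeTerm-zero N ⟩
  onePS ⊖ P N                             ∎

-- Passing from M to M+1 the recurrence leaves Σ_n (teleTerm n - teleTerm (n+1)) S_n;
-- summation by parts turns it into Σ_n teleTerm n · σ n, which equals
-- σ (M+1) Σ_n durfeeTerm (M+1) n = σ (M+1) (1 - (q)_{M+1}) by the Durfee identity.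

innerTerm : ℕ → PS
innerTerm k = Q k ⊛ inv (U k ⊛ U k)

innerSum : ℕ → PS
innerSum n = ΣPS n innerTerm

σ≈innerTerm : ∀ j → σ (suc j) ≈ innerTerm (suc j)
σ≈innerTerm j = ≈-trans (*-assoc (Q (suc j)) (W (suc j)) (W (suc j)))
                (rfl (Q (suc j)) ⟨⊛⟩ ≈-sym (inv-⊛ (U (suc j)) (U (suc j)) refl refl))

teleTerm-σ : ∀ M i → i ℕ.≤ M → teleTerm M (suc i) ⊛ σ (suc i) ≈ σ (suc M) ⊛ durfeeTerm (suc M) (suc i)
teleTerm-σ M i i≤M = begin
  Q (M ℕ.∸ i) ⊛ P M ⊛ binom M i ⊛ q ⊛ J i ⊛ (Q n ⊛ W n ⊛ W n)
    ≈⟨ solve 8 (λ e p b q j x w w′ → e :* p :* b :* q :* j :* (x :* w :* w′) := (e :* x) :* p :* q :* j :* w′ :* (b :* w)) ≈-refl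
         (Q (M ℕ.∸ i)) (P M) (binom M i) q (J i) (Q n) (W n) (W n) ⟩
  (Q (M ℕ.∸ i) ⊛ Q n) ⊛ P M ⊛ q ⊛ J i ⊛ W n ⊛ (binom M i ⊛ W n)
    ≈⟨ ≈-trans (≈-sym (Q-add (M ℕ.∸ i) n)) (Q-cong exponent) ⟨⊛⟩ rfl (P M) ⟨⊛⟩ rfl q ⟨⊛⟩ rfl (J i) ⟨⊛⟩ rfl (W n)
       ⟨⊛⟩ binom-absorb-W M i i≤M ⟩
  Q (suc M) ⊛ P M ⊛ q ⊛ J i ⊛ W n ⊛ (W (suc M) ⊛ binom (suc M) n)
    ≈⟨ solve 7 (λ x p q j w w′ b → x :* p :* q :* j :* w :* (w′ :* b) := x :* w′ :* p :* (b :* q :* (j :* w))) ≈-refl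
         (Q (suc M)) (P M) q (J i) (W n) (W (suc M)) (binom (suc M) n) ⟩
  Q (suc M) ⊛ W (suc M) ⊛ P M ⊛ (binom (suc M) n ⊛ q ⊛ (J i ⊛ W n))
    ≈⟨ σ-step M ⟨⊛⟩ (rfl (binom (suc M) n ⊛ q) ⟨⊛⟩ ≈-sym (J-suc i)) ⟩
  σ (suc M) ⊛ P (suc M) ⊛ (binom (suc M) n ⊛ q ⊛ J n)
    ≈⟨ *-assoc (σ (suc M)) (P (suc M)) (binom (suc M) n ⊛ q ⊛ J n) ⟩
  σ (suc M) ⊛ durfeeTerm (suc M) n ∎
  where
  n = suc i
  q = Q (n ℕ.* n)
  exponent : M ℕ.∸ i ℕ.+ suc i ≡ suc M
  exponent = Eq.trans (ℕP.+-suc (M ℕ.∸ i) i) (cong suc (ℕP.m∸n+n≡m i≤M))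

identityB : ∀ N → ΣPS N (λ n → durfeeTerm N n ⊛ innerSum n) ≈ ΣPS N (λ j → σ j ⊛ (onePS ⊖ P j))
identityB zero    = ≈-refl
identityB (suc M) = begin
  ΣPS M (λ n → durfeeTerm (suc M) n ⊛ innerSum n) ⊕ durfeeTerm (suc M) (suc M) ⊛ innerSum (suc M)
    ≈⟨ ΣPS-cong M (λ n → durfeeTerm (suc M) n ⊛ innerSum n) (λ n → durfeeTerm M n ⊛ innerSum n ⊕ (E n ⊖ E (suc n)) ⊛ innerSum n) step
       ⟨⊕⟩ durfeeTerm-top M ⟨⊛⟩ rfl (innerSum (suc M)) ⟩
  ΣPS M (λ n → durfeeTerm M n ⊛ innerSum n ⊕ (E n ⊖ E (suc n)) ⊛ innerSum n) ⊕ E (suc M) ⊛ (innerSum M ⊕ innerTerm (suc M))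
    ≈⟨ ΣPS-⊕ M (λ n → durfeeTerm M n ⊛ innerSum n) (λ n → (E n ⊖ E (suc n)) ⊛ innerSum n)
       ⟨⊕⟩ rfl (E (suc M) ⊛ (innerSum M ⊕ innerTerm (suc M))) ⟩
  (ΣPS M (λ n → durfeeTerm M n ⊛ innerSum n) ⊕ A) ⊕ E (suc M) ⊛ (innerSum M ⊕ innerTerm (suc M))
    ≈⟨ solve 5 (λ y a e sm x → (y :+ a) :+ e :* (sm :+ x) := y :+ ((a :+ e :* sm) :+ e :* x)) ≈-refl
         (ΣPS M (λ n → durfeeTerm M n ⊛ innerSum n)) A (E (suc M)) (innerSum M) (innerTerm (suc M)) ⟩
  ΣPS M (λ n → durfeeTerm M n ⊛ innerSum n) ⊕ ((A ⊕ E (suc M) ⊛ innerSum M) ⊕ E (suc M) ⊛ innerTerm (suc M))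
    ≈⟨ identityB M ⟨⊕⟩ (summation-by-parts M E innerTerm ⟨⊕⟩ rfl (E (suc M) ⊛ innerTerm (suc M))) ⟩
  Σσ M ⊕ ΣPS (suc M) (λ n → E n ⊛ innerTerm n)
    ≈⟨ rfl (Σσ M) ⟨⊕⟩ ΣPS-cong (suc M) (λ n → E n ⊛ innerTerm n) (λ n → σ (suc M) ⊛ durfeeTerm (suc M) n)
         (λ i i<1+M → ≈-trans (rfl (E (suc i)) ⟨⊛⟩ ≈-sym (σ≈innerTerm i)) (teleTerm-σ M i (ℕP.≤-pred i<1+M))) ⟩
  Σσ M ⊕ ΣPS (suc M) (λ n → σ (suc M) ⊛ durfeeTerm (suc M) n)
    ≈⟨ rfl (Σσ M) ⟨⊕⟩ ≈-trans (≈-sym (ΣPS-⊛ˡ (suc M) (σ (suc M)) (durfeeTerm (suc M)))) (rfl (σ (suc M)) ⟨⊛⟩ durfee-sum (suc M)) ⟩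
  Σσ (suc M) ∎
  where
  E = teleTerm M
  A = ΣPS M (λ n → (E n ⊖ E (suc n)) ⊛ innerSum n)
  Σσ : ℕ → PS
  Σσ N = ΣPS N (λ j → σ j ⊛ (onePS ⊖ P j))
  step : ∀ i → i ℕ.< M → durfeeTerm (suc M) (suc i) ⊛ innerSum (suc i)
                         ≈ durfeeTerm M (suc i) ⊛ innerSum (suc i) ⊕ (E (suc i) ⊖ E (suc (suc i))) ⊛ innerSum (suc i)
  step i i<M = ≈-trans (durfeeTerm-pascal M i i<M ⟨⊛⟩ rfl (innerSum (suc i)))
                       (pw (⊛-distribʳ (innerSum (suc i)) (durfeeTerm M (suc i)) (E (suc i) ⊖ E (suc (suc i)))))

-- Each term is the finite geometric sum Σ_{j=1}^{N} n q^{jn}; exchanging the sums,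
-- Σ_{n=1}^{M} n q^{jn} = σ j - (error) where the error is O(q^{M+1}), so the
-- degree-M coefficients agree.

rhsTerm : ℕ → ℕ → PS
rhsTerm N n = ((+ n • qpow n) ⊛ (onePS ⊖ qpow (N ℕ.* n))) ⊘ (onePS ⊖ qpow n)

U-zero : U 0 ≈ zeroPS
U-zero = pw (λ m → Eq.trans (cong (λ x → onePS m ℤ.- x) (at Q-zero m)) (ℤP.+-inverseʳ (onePS m)))

geomSum : ℕ → ℕ → PS
geomSum N n = ΣPS N (λ j → cst (+ n) ⊛ Q (j ℕ.* n))

geomSum-closed : ∀ N n → cst (+ n) ⊛ Q n ⊛ U (N ℕ.* n) ≈ U n ⊛ geomSum N n
geomSum-closed zero n = begin
  c ⊛ Q n ⊛ U 0    ≈⟨ rfl (c ⊛ Q n) ⟨⊛⟩ U-zero ⟩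
  c ⊛ Q n ⊛ zeroPS ≈⟨ solve 3 (λ c q u → c :* q :* con 0ℤ := u :* con 0ℤ) ≈-refl c (Q n) (U n) ⟩
  U n ⊛ zeroPS     ∎
  where c = cst (+ n)
geomSum-closed (suc N) n = begin
  c ⊛ Q n ⊛ U (n ℕ.+ N ℕ.* n)
    ≈⟨ rfl (c ⊛ Q n) ⟨⊛⟩ U-split (N ℕ.* n) n (n ℕ.+ N ℕ.* n) (≈-trans (Q-cong (ℕP.+-comm n (N ℕ.* n))) (Q-add (N ℕ.* n) n)) ⟩
  c ⊛ Q n ⊛ (U (N ℕ.* n) ⊕ Q (N ℕ.* n) ⊛ U n)
    ≈⟨ solve 5 (λ c q u q′ v → c :* q :* (u :+ q′ :* v) := c :* q :* u :+ v :* (c :* (q :* q′))) ≈-refl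
         c (Q n) (U (N ℕ.* n)) (Q (N ℕ.* n)) (U n) ⟩
  c ⊛ Q n ⊛ U (N ℕ.* n) ⊕ U n ⊛ (c ⊛ (Q n ⊛ Q (N ℕ.* n)))
    ≈⟨ geomSum-closed N n ⟨⊕⟩ rfl (U n) ⟨⊛⟩ (rfl c ⟨⊛⟩ ≈-sym (Q-add n (N ℕ.* n))) ⟩
  U n ⊛ geomSum N n ⊕ U n ⊛ (c ⊛ Q (n ℕ.+ N ℕ.* n))
    ≈⟨ ≈-sym (pw (⊛-distribˡ (U n) (geomSum N n) (c ⊛ Q (n ℕ.+ N ℕ.* n)))) ⟩
  U n ⊛ geomSum (suc N) n ∎
  where c = cst (+ n)

rhsTerm≈geomSum : ∀ N i → rhsTerm N (suc i) ≈ geomSum N (suc i)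
rhsTerm≈geomSum N i = begin
  ((+ n • Q n) ⊛ U (N ℕ.* n)) ⊛ W n     ≈⟨ •≈cst (+ n) (Q n) ⟨⊛⟩ rfl (U (N ℕ.* n)) ⟨⊛⟩ rfl (W n) ⟩
  cst (+ n) ⊛ Q n ⊛ U (N ℕ.* n) ⊛ W n   ≈⟨ geomSum-closed N n ⟨⊛⟩ rfl (W n) ⟩
  U n ⊛ geomSum N n ⊛ W n               ≈⟨ solve 3 (λ u h w → u :* h :* w := h :* (u :* w)) ≈-refl (U n) (geomSum N n) (W n) ⟩
  geomSum N n ⊛ (U n ⊛ W n)             ≈⟨ rfl (geomSum N n) ⟨⊛⟩ U-W i ⟩
  geomSum N n ⊛ onePS                   ≈⟨ ⊛-identityʳ (geomSum N n) ⟩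
  geomSum N n                           ∎
  where n = suc i

partialSum : ℕ → ℕ → PS
partialSum j M = ΣPS M (λ n → cst (+ n) ⊛ Q (j ℕ.* n))

err : ℕ → ℕ → PS
err j M = cst (+ suc M) ⊛ Q (j ℕ.* suc M) ⊖ cst (+ M) ⊛ Q (j ℕ.* suc (suc M))

Q-mul-suc : ∀ j m → Q (j ℕ.* suc m) ≈ Q (j ℕ.* m) ⊛ Q j
Q-mul-suc j m = ≈-trans (Q-cong (Eq.trans (ℕP.*-suc j m) (ℕP.+-comm j (j ℕ.* m)))) (Q-add (j ℕ.* m) j)

err-expand : ∀ j M → err j M ≈ cst (+ suc M) ⊛ Q (j ℕ.* suc M) ⊖ cst (+ M) ⊛ (Q (j ℕ.* suc M) ⊛ Q j)
err-expand j M = rfl (cst (+ suc M) ⊛ Q (j ℕ.* suc M)) ⟨⊖⟩ rfl (cst (+ M)) ⟨⊛⟩ Q-mul-suc j (suc M)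

partialSum-closed : ∀ j M → partialSum j M ⊛ (U j ⊛ U j) ≈ Q j ⊖ err j M
partialSum-closed j zero = begin
  zeroPS ⊛ (U j ⊛ U j)        ≈⟨ solve 3 (λ u x a → con 0ℤ :* (u :* u) := x :- (con 1ℤ :* x :- con 0ℤ :* a)) ≈-refl (U j) (Q j) (Q (j ℕ.* 2)) ⟩
  Q j ⊖ (cst 1ℤ ⊛ Q j ⊖ cst 0ℤ ⊛ Q (j ℕ.* 2)) ≈⟨ rfl (Q j) ⟨⊖⟩ (rfl (cst 1ℤ) ⟨⊛⟩ Q-cong (Eq.sym (ℕP.*-identityʳ j)) ⟨⊖⟩ rfl (cst 0ℤ ⊛ Q (j ℕ.* 2))) ⟩
  Q j ⊖ err j 0               ∎
partialSum-closed j (suc M) = begin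
  (partialSum j M ⊕ cst (+ suc M) ⊛ a) ⊛ (U j ⊛ U j)
    ≈⟨ pw (⊛-distribʳ (U j ⊛ U j) (partialSum j M) _) ⟩
  partialSum j M ⊛ (U j ⊛ U j) ⊕ cst (+ suc M) ⊛ a ⊛ (U j ⊛ U j)
    ≈⟨ ≈-trans (partialSum-closed j M) (rfl (Q j) ⟨⊖⟩ err-expand j M) ⟨⊕⟩ cst-suc M ⟨⊛⟩ rfl a ⟨⊛⟩ (U≈cst j ⟨⊛⟩ U≈cst j) ⟩
  (x ⊖ (cst (+ suc M) ⊛ a ⊖ m ⊛ (a ⊛ x))) ⊕ (cst 1ℤ ⊕ m) ⊛ a ⊛ ((cst 1ℤ ⊖ x) ⊛ (cst 1ℤ ⊖ x))
    ≈⟨ rfl x ⟨⊖⟩ (cst-suc M ⟨⊛⟩ rfl a ⟨⊖⟩ rfl (m ⊛ (a ⊛ x))) ⟨⊕⟩ rfl ((cst 1ℤ ⊕ m) ⊛ a ⊛ ((cst 1ℤ ⊖ x) ⊛ (cst 1ℤ ⊖ x))) ⟩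
  (x ⊖ ((cst 1ℤ ⊕ m) ⊛ a ⊖ m ⊛ (a ⊛ x))) ⊕ (cst 1ℤ ⊕ m) ⊛ a ⊛ ((cst 1ℤ ⊖ x) ⊛ (cst 1ℤ ⊖ x))
    ≈⟨ solve 3 (λ x m a → (x :- ((con 1ℤ :+ m) :* a :- m :* (a :* x))) :+ (con 1ℤ :+ m) :* a :* ((con 1ℤ :- x) :* (con 1ℤ :- x))
                          := x :- ((con 1ℤ :+ (con 1ℤ :+ m)) :* (a :* x) :- (con 1ℤ :+ m) :* (a :* x :* x))) ≈-refl x m a ⟩
  x ⊖ ((cst 1ℤ ⊕ (cst 1ℤ ⊕ m)) ⊛ (a ⊛ x) ⊖ (cst 1ℤ ⊕ m) ⊛ (a ⊛ x ⊛ x))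
    ≈⟨ rfl x ⟨⊖⟩ ≈-sym (≈-trans (cst-suc (suc M)) (rfl (cst 1ℤ) ⟨⊕⟩ cst-suc M) ⟨⊛⟩ Q-mul-suc j (suc M)
                       ⟨⊖⟩ cst-suc M ⟨⊛⟩ ≈-trans (Q-mul-suc j (suc (suc M))) (Q-mul-suc j (suc M) ⟨⊛⟩ rfl x)) ⟩
  Q j ⊖ err j (suc M) ∎
  where
  a = Q (j ℕ.* suc M)
  x = Q j
  m = cst (+ M)

tail : ℕ → ℕ → PS
tail M j = err j M ⊛ W j ⊛ W j

partialSum≈σ : ∀ j M → partialSum (suc j) M ≈ σ (suc j) ⊖ tail M (suc j)
partialSum≈σ j M = begin
  V                               ≈⟨ ≈-sym (⊛-identityʳ V) ⟩
  V ⊛ onePS                       ≈⟨ rfl V ⟨⊛⟩ ≈-sym (≈-trans (U-W j ⟨⊛⟩ U-W j) (⊛-identityˡ onePS)) ⟩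
  V ⊛ ((u ⊛ w) ⊛ (u ⊛ w))         ≈⟨ solve 3 (λ v u w → v :* ((u :* w) :* (u :* w)) := v :* (u :* u) :* w :* w) ≈-refl V u w ⟩
  V ⊛ (u ⊛ u) ⊛ w ⊛ w             ≈⟨ partialSum-closed (suc j) M ⟨⊛⟩ rfl w ⟨⊛⟩ rfl w ⟩
  (Q (suc j) ⊖ err (suc j) M) ⊛ w ⊛ w
    ≈⟨ solve 3 (λ x e w → (x :- e) :* w :* w := x :* w :* w :- e :* w :* w) ≈-refl (Q (suc j)) (err (suc j) M) w ⟩
  σ (suc j) ⊖ tail M (suc j)      ∎
  where
  V = partialSum (suc j) M
  u = U (suc j)
  w = W (suc j)

VanishesBelow : ℕ → PS → Set
VanishesBelow k a = ∀ i → i ℕ.< k → a i ≡ 0ℤ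

vanish-⊛ˡ : ∀ k a b → VanishesBelow k a → VanishesBelow k (a ⊛ b)
vanish-⊛ˡ k a b h i i<k = Σ≤-vanish i _ (λ l l≤i → cong (ℤ._* b (i ℕ.∸ l)) (h l (ℕP.≤-<-trans l≤i i<k)))

vanish-⊛ʳ : ∀ k a b → VanishesBelow k b → VanishesBelow k (a ⊛ b)
vanish-⊛ʳ k a b h i i<k = Eq.trans (⊛-comm a b i) (vanish-⊛ˡ k b a h i i<k)

vanish-⊖ : ∀ k a b → VanishesBelow k a → VanishesBelow k b → VanishesBelow k (a ⊖ b)
vanish-⊖ k a b ha hb i i<k = cong₂ ℤ._-_ (ha i i<k) (hb i i<k)

vanish-Q : ∀ k j → k ℕ.≤ j → VanishesBelow k (Q j)
vanish-Q k j k≤j i i<k = qpow-off j i (λ { refl → ℕP.<-irrefl refl (ℕP.<-≤-trans i<k k≤j) })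

vanish-ΣPS : ∀ k N f → (∀ i → i ℕ.< N → VanishesBelow k (f (suc i))) → VanishesBelow k (ΣPS N f)
vanish-ΣPS k zero    f h i _   = refl
vanish-ΣPS k (suc N) f h i i<k =
  cong₂ ℤ._+_ (vanish-ΣPS k N f (λ l l<N → h l (ℕP.m<n⇒m<1+n l<N)) i i<k) (h N ℕP.≤-refl i i<k)

-- Both terms of err (j+1) M are multiples of q^{M+1}, hence so is the tail.
tail-vanishes : ∀ M j → VanishesBelow (suc M) (tail M (suc j))
tail-vanishes M j = vanish-⊛ˡ (suc M) _ (W (suc j)) (vanish-⊛ˡ (suc M) _ (W (suc j)) (vanish-⊖ (suc M) _ _
  (vanish-⊛ʳ (suc M) (cst (+ suc M)) _ (vanish-Q (suc M) _ (ℕP.m≤n*m (suc M) (suc j))))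
  (vanish-⊛ʳ (suc M) (cst (+ M)) _ (vanish-Q (suc M) _ (ℕP.≤-trans (ℕP.n≤1+n (suc M)) (ℕP.m≤n*m (suc (suc M)) (suc j)))))))

identityC : ∀ N → ΣPS∞ (rhsTerm N) ≈ ΣPS N σ
identityC N = pw coeff
  where
  truncated : ∀ M → ΣPS M (rhsTerm N) ≈ ΣPS N σ ⊖ ΣPS N (tail M)
  truncated M = begin
    ΣPS M (rhsTerm N)                      ≈⟨ ΣPS-cong M (rhsTerm N) (geomSum N) (λ i _ → rhsTerm≈geomSum N i) ⟩
    ΣPS M (geomSum N)                      ≈⟨ ΣPS-swap M N (λ n j → cst (+ n) ⊛ Q (j ℕ.* n)) ⟩
    ΣPS N (λ j → partialSum j M)           ≈⟨ ΣPS-cong N (λ j → partialSum j M) (λ j → σ j ⊖ tail M j) (λ j _ → partialSum≈σ j M) ⟩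
    ΣPS N (λ j → σ j ⊖ tail M j)           ≈⟨ ΣPS-⊖ N σ (tail M) ⟩
    ΣPS N σ ⊖ ΣPS N (tail M)               ∎

  coeff : ∀ M → ΣPS∞ (rhsTerm N) M ≡ ΣPS N σ M
  coeff M = Eq.trans (at (truncated M) M)
    (Eq.trans (cong (λ z → ΣPS N σ M ℤ.- z) (vanish-ΣPS (suc M) N (tail M) (λ j _ → tail-vanishes M j) M ℕP.≤-refl))
              (ℤP.+-identityʳ (ΣPS N σ M)))

lhs₁-closed : ∀ N → lhs₁ N ≈ ΣPS N (λ j → σ j ⊛ P j) ⊛ J N
lhs₁-closed N = ≈-trans (ΣPS-cong N _ (termA N) (λ i _ → term≈termA (suc i))) (identityA N) ⟨⊛⟩ rfl (J N)
  where
  term≈termA : ∀ n → (qBinom N n ⊛ ((sgn (n ℕ.∸ 1) ℤ.* + n) • qpow (T n))) ⊘ (onePS ⊖ qpow n) ≈ termA N n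
  term≈termA n = qBinom≈binom N n ⟨⊛⟩ ≈-trans (•≈cst (sgn (n ℕ.∸ 1) ℤ.* + n) (Q (T n))) (cst-* (sgn (n ℕ.∸ 1)) (+ n) ⟨⊛⟩ rfl (Q (T n)))
                 ⟨⊛⟩ rfl (W n)

lhs₂-closed : ∀ N → lhs₂ N ≈ ΣPS N (λ j → σ j ⊛ (onePS ⊖ P j)) ⊛ J N
lhs₂-closed N = begin
  lhs₂ N                                          ≈⟨ ΣPS-cong N _ (λ n → c n ⊛ innerSum n) (λ i _ → term≈ (suc i)) ⟩
  L                                               ≈⟨ ≈-sym cancel-P ⟩
  P N ⊛ L ⊛ J N                                   ≈⟨ distribute ⟨⊛⟩ rfl (J N) ⟩
  ΣPS N (λ n → durfeeTerm N n ⊛ innerSum n) ⊛ J N ≈⟨ identityB N ⟨⊛⟩ rfl (J N) ⟩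
  ΣPS N (λ j → σ j ⊛ (onePS ⊖ P j)) ⊛ J N         ∎
  where
  c : ℕ → PS
  c n = binom N n ⊛ Q (n ℕ.* n) ⊛ J n
  L = ΣPS N (λ n → c n ⊛ innerSum n)

  term≈ : ∀ n → qBinom N n ⊛ Q (n ℕ.* n) ⊛ J n ⊛ innerSum n ≈ c n ⊛ innerSum n
  term≈ n = qBinom≈binom N n ⟨⊛⟩ rfl (Q (n ℕ.* n)) ⟨⊛⟩ rfl (J n) ⟨⊛⟩ rfl (innerSum n)

  cancel-P : P N ⊛ L ⊛ J N ≈ L
  cancel-P = begin
    P N ⊛ L ⊛ J N   ≈⟨ solve 3 (λ p l j → p :* l :* j := (p :* j) :* l) ≈-refl (P N) L (J N) ⟩
    P N ⊛ J N ⊛ L   ≈⟨ P-J N ⟨⊛⟩ rfl L ⟩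
    onePS ⊛ L       ≈⟨ ⊛-identityˡ L ⟩
    L               ∎

  distribute : P N ⊛ L ≈ ΣPS N (λ n → durfeeTerm N n ⊛ innerSum n)
  distribute = ≈-trans (ΣPS-⊛ˡ N (P N) (λ n → c n ⊛ innerSum n))
    (ΣPS-cong N _ (λ n → durfeeTerm N n ⊛ innerSum n) (λ i _ → ≈-sym (*-assoc (P N) (c (suc i)) (innerSum (suc i)))))

rhs-closed : ∀ N → rhs N ≈ ΣPS N σ ⊛ J N
rhs-closed N = identityC N ⟨⊛⟩ rfl (J N)

σ-split : ∀ N → ΣPS N (λ j → σ j ⊛ P j) ⊕ ΣPS N (λ j → σ j ⊛ (onePS ⊖ P j)) ≈ ΣPS N σ
σ-split N = ≈-trans (≈-sym (ΣPS-⊕ N (λ j → σ j ⊛ P j) (λ j → σ j ⊛ (onePS ⊖ P j))))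
                    (ΣPS-cong N _ σ (λ i _ → recombine (σ (suc i)) (P (suc i))))
  where
  recombine : ∀ x p → x ⊛ p ⊕ x ⊛ (onePS ⊖ p) ≈ x
  recombine x p = ≈-trans (rfl (x ⊛ p) ⟨⊕⟩ rfl x ⟨⊛⟩ (onePS≈cst ⟨⊖⟩ rfl p))
    (≈-trans (solve 2 (λ x p → x :* p :+ x :* (con 1ℤ :- p) := x :* con 1ℤ) ≈-refl x p)
             (≈-trans (rfl x ⟨⊛⟩ ≈-sym onePS≈cst) (⊛-identityʳ x)))

theorem2p1 : (N : ℕ) → (m : ℕ) → (lhs₁ N ⊕ lhs₂ N) m ≡ rhs N m
theorem2p1 N = at (begin
  lhs₁ N ⊕ lhs₂ N                                 ≈⟨ lhs₁-closed N ⟨⊕⟩ lhs₂-closed N ⟩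
  ΣPS N (λ j → σ j ⊛ P j) ⊛ J N ⊕ ΣPS N (λ j → σ j ⊛ (onePS ⊖ P j)) ⊛ J N
    ≈⟨ ≈-sym (pw (⊛-distribʳ (J N) (ΣPS N (λ j → σ j ⊛ P j)) (ΣPS N (λ j → σ j ⊛ (onePS ⊖ P j))))) ⟩
  (ΣPS N (λ j → σ j ⊛ P j) ⊕ ΣPS N (λ j → σ j ⊛ (onePS ⊖ P j))) ⊛ J N
                                                  ≈⟨ σ-split N ⟨⊛⟩ rfl (J N) ⟩
  ΣPS N σ ⊛ J N                                   ≈⟨ ≈-sym (rhs-closed N) ⟩
  rhs N                                           ∎)
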